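{- Let $U$ be a row-strict composition tableau with $k$ rows and longest row of length $m$, and let $a,b,c$ be positive integers with $a<b\le c$. Let $U_1=(U\leftarrow b)\leftarrow c$ and $U_2=(U\leftarrow b)\leftarrow a$. Let $B_a=(i_a,j_a)$, $B_b=(i_b,j_b)$, $B_c=(i_c,j_c)$ be the new boxes created by inserting $a$, $b$, $c$ respectively into the appropriate tableau. Then: (1) In $U_1$, $j_c\le j_b$; in $U_2$, $j_a>j_b$. (2) If a row $i_1$ of $U_1$ contains a box $(i_1,j_1)$ of the insertion path $I(b)$ and a box $(i_1,j_1')$ of the insertion path $I(c)$, then $j_1'\le j_1$. If a row $i_2$ of $U_2$ contains a box $(i_2,j_2)$ of $I(b)$ and a box $(i_2,j_2')$ of $I(a)$, then $j_2'>j_2$.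
   Context: Diagrams: row $i$ of the diagram of a strong composition $\alpha$ has $\alpha_i$ left-justified boxes; $(i,j)$ is row $i$ (from the top), column $j$. A row-strict composition tableau (RCT) of shape $\alpha$ ($k$ parts, largest part $m$) is a filling with positive integers such that the first column weakly increases top to bottom, each row strictly decreases left to right, and (Triple Rule) after padding rows with zeros to a $k\times m$ array $\hat U$, for $1\le i_1<i_2\le k$, $2\le j\le m$: $\hat U(i_2,j)\neq0$ and $\hat U(i_2,j)>\hat U(i_1,j)$ imply $\hat U(i_2,j)\ge\hat U(i_1,j-1)$. RCT insertion $U\leftarrow b$ ($U$ an RCT with longest row length $m$, $b$ a positive integer): scan $U$ column by column from right to left, each column from top to bottom, starting in column $m+1$ with $b$ in hand. (1) In column $m+1$: if the current position is at the end of a row of length $m$ and $b$ is strictly less than the last entry of that row, place $b$ there and stop; otherwise continue at the top of column $m$. (2) Inductively, with entry $b_j$ in hand at the top of column $j$: (a) if the current position is empty, is at the end of a row of length $j-1$, and $b_j$ is strictly less than the last entry of that row, place $b_j$ there and stop; (b) if the current position is nonempty and holds $\tilde b_j\le b_j$ with $b_j$ strictly less than the entry immediately to the left of $\tilde b_j$, then $b_j$ replaces (bumps) $\tilde b_j$ and scanning of column $j$ continues with $\tilde b_j$ in hand, bumping whenever possible; after the last entry of column $j$, scanning continues at the top of column $j-1$ with the current entry in hand. (3) If an entry $b_1$ is bumped into the first column, it is placed in a new row of length one that appears directly after the lowest row whose first-column entry is weakly less than $b_1$. The result is an RCT. The box where the algorithm stops (or the new row's box) is the new box created by the insertion. The insertion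 path $I(b)$ is the set of boxes of $U\leftarrow b$ containing an entry placed during the algorithm (the boxes where bumps occurred together with the new box). -}

module Defs where

open import Data.Nat using (ℕ; zero; suc; _≤_; _<_; _∸_; _⊔_; _≡ᵇ_; _<ᵇ_; _≤ᵇ_)
open import Data.Bool using (Bool; true; false; if_then_else_; _∧_)
open import Data.List using (List; []; _∷_; _++_; [_]; length; map; take; drop; foldr)
open import Data.Maybe using (Maybe; just; nothing; fromMaybe; maybe′)
open import Data.Product using (_×_; _,_)
open import Function using (id)
open import Relation.Binary.PropositionalEquality using (_≢_)

-- A tableau is a list of rows (top to bottom); a row is its list of
-- entries read left to right.  Its shape is the list of row lengths.
Row : Set
Row = List ℕ

Tab : Set
Tab = List Row

-- 0-indexed list lookup
nth : {A : Set} → List A → ℕ → Maybe A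
nth []       _       = nothing
nth (x ∷ xs) zero    = just x
nth (x ∷ xs) (suc n) = nth xs n

numRows : Tab → ℕ
numRows = length

maxLen : Tab → ℕ
maxLen = foldr (λ r m → length r ⊔ m) 0

-- length of row i (1-indexed); 0 outside
rowLen : Tab → ℕ → ℕ
rowLen T zero    = 0
rowLen T (suc i) = maybe′ length 0 (nth T i)

-- The zero-padded array  Û(i,j)  (1-indexed rows and columns; 0 outside the diagram).
entry : Tab → ℕ → ℕ → ℕ
entry T zero    _       = 0
entry T (suc i) zero    = 0
entry T (suc i) (suc j) = maybe′ (λ r → fromMaybe 0 (nth r j)) 0 (nth T i)

record IsRCT (U : Tab) : Set where
  field
    rowsNonempty : ∀ i → 1 ≤ i → i ≤ numRows U → 1 ≤ rowLen U i
    positive     : ∀ i j → 1 ≤ i → i ≤ numRows U → 1 ≤ j → j ≤ rowLen U i → 1 ≤ entry U i j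
    firstCol     : ∀ i → 1 ≤ i → i < numRows U → entry U i 1 ≤ entry U (suc i) 1
    rowStrict    : ∀ i j → 1 ≤ i → i ≤ numRows U → 1 ≤ j → suc j ≤ rowLen U i →
                   entry U i (suc j) < entry U i j
    triple       : ∀ i₁ i₂ j → 1 ≤ i₁ → i₁ < i₂ → i₂ ≤ numRows U → 2 ≤ j → j ≤ maxLen U →
                   entry U i₂ j ≢ 0 → entry U i₁ j < entry U i₂ j →
                   entry U i₁ (j ∸ 1) ≤ entry U i₂ j

-- RCT insertion.  Internally columns are 0-indexed positions c (column c+1);
-- boxes are reported 1-indexed as (row , column).

replaceAt : Row → ℕ → ℕ → Row
replaceAt []       _       _ = []
replaceAt (y ∷ ys) zero    x = x ∷ ys
replaceAt (y ∷ ys) (suc n) x = y ∷ replaceAt ys n x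

data Step : Set where
  placed : Row → Step
  bumped : Row → ℕ → Step
  skip   : Step

-- Examine position c (0-based, c ≥ 1, i.e. column c+1 ≥ 2) of row r with x in hand.
stepRow : ℕ → ℕ → Row → Step
stepRow c x r with nth r (c ∸ 1) | nth r c
... | just l  | nothing = if (length r ≡ᵇ c) ∧ (x <ᵇ l) then placed (r ++ [ x ]) else skip
... | just l  | just y  = if (y ≤ᵇ x) ∧ (x <ᵇ l) then bumped (replaceAt r c x) y else skip
... | nothing | _       = skip

data ColRes : Set where
  -- algorithm stopped: new rows, boxes where bumps occurred, new box
  stop : Tab → List (ℕ × ℕ) → (ℕ × ℕ) → ColRes
  -- algorithm continues: new rows, boxes where bumps occurred, entry in hand
  go   : Tab → List (ℕ × ℕ) → ℕ → ColRes

consRow : Row → ColRes → ColRes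
consRow r (stop T ps b) = stop (r ∷ T) ps b
consRow r (go T ps x)   = go (r ∷ T) ps x

consBump : Row → (ℕ × ℕ) → ColRes → ColRes
consBump r p (stop T ps b) = stop (r ∷ T) (p ∷ ps) b
consBump r p (go T ps x)   = go (r ∷ T) (p ∷ ps) x

-- scan column c+1 top to bottom; i = 0-based index of the current row
scanCol : ℕ → ℕ → ℕ → Tab → ColRes
scanCol c i x []       = go [] [] x
scanCol c i x (r ∷ rs) with stepRow c x r
... | placed r'   = stop (r' ∷ rs) [] (suc i , suc c)
... | bumped r' y = consBump r' (suc i , suc c) (scanCol c (suc i) y rs)
... | skip        = consRow r (scanCol c (suc i) x rs)

addBumps : List (ℕ × ℕ) → ColRes → ColRes
addBumps ps (stop T qs b) = stop T (ps ++ qs) b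
addBumps ps (go T qs x)   = go T (ps ++ qs) x

-- process columns k+1, k, ..., 2 (0-based positions k, ..., 1)
insCols : ℕ → ℕ → Tab → ColRes
insCols zero    x T = go T [] x
insCols (suc k) x T with scanCol (suc k) 0 x T
... | stop T' ps b = stop T' ps b
... | go T' ps y   = addBumps ps (insCols k y T')

headLE : ℕ → Row → Bool
headLE y []      = false
headLE y (h ∷ _) = h ≤ᵇ y

-- number of rows up to and including the lowest row whose first entry is ≤ y
-- (0 if there is none); the new row is inserted directly after that row.
newRowPos : ℕ → Tab → ℕ
newRowPos y [] = 0
newRowPos y (r ∷ rs) with newRowPos y rs
... | suc p = suc (suc p)
... | zero  = if headLE y r then 1 else 0

-- 1-indexed row i of the old tableau ↦ its index after a new row is put
-- after the first p rows
shiftRow : ℕ → ℕ → ℕ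
shiftRow p i = if i ≤ᵇ p then i else suc i

shiftBox : ℕ → ℕ × ℕ → ℕ × ℕ
shiftBox p (i , j) = (shiftRow p i , j)

record InsResult : Set where
  field
    tab    : Tab
    newBox : ℕ × ℕ              -- the new box (row , column), 1-indexed
    path   : List (ℕ × ℕ)       -- insertion path I(b) (boxes of U ← b)
    rowMap : ℕ → ℕ              -- row i of U is row (rowMap i) of U ← b
open InsResult public

insert : Tab → ℕ → InsResult
insert U b with insCols (maxLen U) b U
... | stop T ps B = record { tab = T ; newBox = B ; path = ps ++ [ B ] ; rowMap = id }
... | go T ps y   =
  let p = newRowPos y T in
  record { tab    = take p T ++ [ y ] ∷ drop p T
         ; newBox = (suc p , 1)
         ; path   = map (shiftBox p) ps ++ [ (suc p , 1) ]
         ; rowMap = shiftRow p }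

rowOf colOf : ℕ × ℕ → ℕ
rowOf (i , _) = i
colOf (_ , j) = j

module Submission where

-- The only property of U the argument needs is that its rows
-- strictly decrease (rct-decreasing), and insertion preserves it.
--
-- An insertion is a sweep of column scans from right to left (sweep,
-- insCols≡sweep).  For c ≥ b the two sweeps are compared
-- column by column (scanC, sweepC): c carries on at least what b does, and
-- c's boxes sit in rows whose entry one column to the left exceeds all
-- that b still places, so c stays weakly left of b.  For a < b, a's scan
-- of each column is compared with b's scan of the column to its left
-- (scanA, sweepA): a stays strictly right of b.  A new row [y] created by b
-- is inert for the later insertion except in column 2 (sweep-insertRow,
-- scan-stopsAt).

open import Defs
open import Data.Nat
open import Data.Nat.Properties
open import Data.Bool using (true; false)
open import Data.Bool.Properties using (T-≡)
open import Data.List using (List; []; _∷_; _++_; [_]; length; map; take; drop)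
open import Data.List.Properties using (++-assoc; map-++)
open import Data.List.Relation.Unary.All as All using (All; []; _∷_)
import Data.List.Relation.Unary.All.Properties as All
open import Data.List.Relation.Unary.Any using (here; there)
open import Data.List.Relation.Binary.Pointwise as Pointwise using (Pointwise; []; _∷_)
open import Data.List.Membership.Propositional using (_∈_)
open import Data.List.Membership.Propositional.Properties using (∈-++⁻; ∈-map⁻)
open import Data.Maybe using (just; nothing; maybe′)
open import Data.Product using (_×_; _,_; ∃; proj₁; proj₂)
open import Data.Sum using (_⊎_; inj₁; inj₂; map₂)
open import Data.Empty using (⊥; ⊥-elim)
open import Data.Unit using (⊤; tt)
open import Function using (id; Equivalence)
open import Relation.Binary.PropositionalEquality hiding ([_])
open import Relation.Nullary using (yes; no)
open import Relation.Nullary.Reflects using (ofʸ; ofⁿ)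

nth-last : ∀ (r : Row) k {l} → nth r k ≡ just l → nth r (suc k) ≡ nothing → length r ≡ suc k
nth-last (x ∷ []) zero e₁ e₂ = refl
nth-last (x ∷ r) (suc k) e₁ e₂ = cong suc (nth-last r k e₁ e₂)

nth-pred : ∀ (r : Row) k {v} → nth r (suc k) ≡ just v → ∃ λ u → nth r k ≡ just u
nth-pred (x ∷ r) zero e = x , refl
nth-pred (x ∷ r) (suc k) e = nth-pred r k e

nth-beyond : ∀ (r : Row) k → length r ≤ k → nth r k ≡ nothing
nth-beyond [] k _ = refl
nth-beyond (x ∷ r) (suc k) (s≤s p) = nth-beyond r k p

nth-just⇒< : ∀ {A : Set} (r : List A) m {v} → nth r m ≡ just v → m < length r
nth-just⇒< (x ∷ r) zero e = s≤s z≤n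
nth-just⇒< (x ∷ r) (suc m) e = s≤s (nth-just⇒< r m e)

nth-replaceAt-≡ : ∀ (r : Row) q x {y} → nth r q ≡ just y → nth (replaceAt r q x) q ≡ just x
nth-replaceAt-≡ (z ∷ r) zero x e = refl
nth-replaceAt-≡ (z ∷ r) (suc q) x e = nth-replaceAt-≡ r q x e

nth-replaceAt-≢ : ∀ (r : Row) q x j → j ≢ q → nth (replaceAt r q x) j ≡ nth r j
nth-replaceAt-≢ [] q x j ne = refl
nth-replaceAt-≢ (z ∷ r) zero x zero ne = ⊥-elim (ne refl)
nth-replaceAt-≢ (z ∷ r) zero x (suc j) ne = refl
nth-replaceAt-≢ (z ∷ r) (suc q) x zero ne = refl
nth-replaceAt-≢ (z ∷ r) (suc q) x (suc j) ne = nth-replaceAt-≢ r q x j (λ e → ne (cong suc e))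

nth-append-≡ : ∀ (r : Row) x → nth (r ++ [ x ]) (length r) ≡ just x
nth-append-≡ [] x = refl
nth-append-≡ (z ∷ r) x = nth-append-≡ r x

nth-append-≢ : ∀ (r : Row) x j → j ≢ length r → nth (r ++ [ x ]) j ≡ nth r j
nth-append-≢ [] x zero ne = ⊥-elim (ne refl)
nth-append-≢ [] x (suc j) ne = refl
nth-append-≢ (z ∷ r) x zero ne = refl
nth-append-≢ (z ∷ r) x (suc j) ne = nth-append-≢ r x j (λ e → ne (cong suc e))

just≢nothing : ∀ {A : Set} {a : A} → just a ≢ nothing
just≢nothing ()

just-injective : ∀ {A : Set} {a b : A} → just a ≡ just b → a ≡ b
just-injective refl = refl

Skip : ℕ → ℕ → Row → Set
Skip k x r = nth r k ≡ nothing
           ⊎ (∃ λ l → nth r k ≡ just l × l ≤ x)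
           ⊎ (∃ λ l → ∃ λ y → nth r k ≡ just l × x < l × nth r (suc k) ≡ just y × x < y)

data StepView (k x : ℕ) (r : Row) : Step → Set where
  placed : ∀ l → nth r k ≡ just l → x < l → nth r (suc k) ≡ nothing → length r ≡ suc k →
           StepView k x r (placed (r ++ [ x ]))
  bumped : ∀ l y → nth r k ≡ just l → x < l → nth r (suc k) ≡ just y → y ≤ x →
           StepView k x r (bumped (replaceAt r (suc k) x) y)
  skip   : Skip k x r → StepView k x r skip

≡ᵇ-true : ∀ {m n} → m ≡ n → (m ≡ᵇ n) ≡ true
≡ᵇ-true {m} {n} e = Equivalence.to T-≡ (≡⇒≡ᵇ m n e)

stepView : ∀ k x r → StepView k x r (stepRow (suc k) x r)
stepView k x r with nth r k in e₁ | nth r (suc k) in e₂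
... | nothing | _ = skip (inj₁ e₁)
... | just l | nothing rewrite ≡ᵇ-true (nth-last r k e₁ e₂) with x <ᵇ l | <ᵇ-reflects-< x l
...   | true  | ofʸ x<l = placed l e₁ x<l e₂ (nth-last r k e₁ e₂)
...   | false | ofⁿ x≮l = skip (inj₂ (inj₁ (l , e₁ , ≮⇒≥ x≮l)))
stepView k x r | just l | just y with y ≤ᵇ x | ≤ᵇ-reflects-≤ y x | x <ᵇ l | <ᵇ-reflects-< x l
... | true  | ofʸ y≤x | true  | ofʸ x<l = bumped l y e₁ x<l e₂ y≤x
... | true  | ofʸ _   | false | ofⁿ x≮l = skip (inj₂ (inj₁ (l , e₁ , ≮⇒≥ x≮l)))
... | false | ofⁿ _   | false | ofⁿ x≮l = skip (inj₂ (inj₁ (l , e₁ , ≮⇒≥ x≮l)))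
... | false | ofⁿ y≰x | true  | ofʸ x<l = skip (inj₂ (inj₂ (l , y , e₁ , x<l , e₂ , ≰⇒> y≰x)))

-- Bookkeeping for the result of a (partial) run: the rows produced, the
-- boxes where entries were placed, and the entry still in hand (0 once the
-- run has stopped).

resTab : ColRes → Tab
resTab (stop T _ _) = T
resTab (go T _ _) = T

boxes : ColRes → List (ℕ × ℕ)
boxes (stop _ ps B) = ps ++ [ B ]
boxes (go _ ps _) = ps

carried : ColRes → ℕ
carried (stop _ _ _) = 0
carried (go _ _ y) = y

resTab-consBump : ∀ r b R → resTab (consBump r b R) ≡ r ∷ resTab R
resTab-consBump r b (stop _ _ _) = refl
resTab-consBump r b (go _ _ _) = refl

resTab-consRow : ∀ r R → resTab (consRow r R) ≡ r ∷ resTab R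
resTab-consRow r (stop _ _ _) = refl
resTab-consRow r (go _ _ _) = refl

resTab-addBumps : ∀ ps R → resTab (addBumps ps R) ≡ resTab R
resTab-addBumps ps (stop _ _ _) = refl
resTab-addBumps ps (go _ _ _) = refl

boxes-consBump : ∀ {P : ℕ × ℕ → Set} {r b} R → P b → All P (boxes R) → All P (boxes (consBump r b R))
boxes-consBump (stop _ _ _) p a = p ∷ a
boxes-consBump (go _ _ _) p a = p ∷ a

boxes-consRow : ∀ {P : ℕ × ℕ → Set} {r} R → All P (boxes R) → All P (boxes (consRow r R))
boxes-consRow (stop _ _ _) a = a
boxes-consRow (go _ _ _) a = a

boxes-addBumps : ∀ ps R → boxes (addBumps ps R) ≡ ps ++ boxes R
boxes-addBumps ps (stop T qs B) = ++-assoc ps qs [ B ]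
boxes-addBumps ps (go _ _ _) = refl

carried-consBump : ∀ r b R → carried (consBump r b R) ≡ carried R
carried-consBump r b (stop _ _ _) = refl
carried-consBump r b (go _ _ _) = refl

carried-consRow : ∀ r R → carried (consRow r R) ≡ carried R
carried-consRow r (stop _ _ _) = refl
carried-consRow r (go _ _ _) = refl

carried-addBumps : ∀ ps R → carried (addBumps ps R) ≡ carried R
carried-addBumps ps (stop _ _ _) = refl
carried-addBumps ps (go _ _ _) = refl

stop∈boxes : ∀ T ps B → B ∈ boxes (stop T ps B)
stop∈boxes T [] B = here refl
stop∈boxes T (p ∷ ps) B = there (stop∈boxes T ps B)

-- Bumped entries only get smaller: the entry carried out of a column scan
-- is at most the entry carried in.
scan-carried : ∀ k i x V → carried (scanCol (suc k) i x V) ≤ x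
scan-carried k i x [] = ≤-refl
scan-carried k i x (r ∷ V) with stepRow (suc k) x r | stepView k x r
... | .(placed _) | placed _ _ _ _ _ = z≤n
... | .(bumped _ y) | bumped _ y _ _ _ y≤x =
  subst (_≤ x) (sym (carried-consBump _ _ (scanCol (suc k) (suc i) y V))) (≤-trans (scan-carried k (suc i) y V) y≤x)
... | .skip | skip _ =
  subst (_≤ x) (sym (carried-consRow _ (scanCol (suc k) (suc i) x V))) (scan-carried k (suc i) x V)

Pointwise-nth : ∀ {R : Row → Row → Set} {xs ys} n {r} → Pointwise R xs ys → nth xs n ≡ just r →
                ∃ λ s → nth ys n ≡ just s × R r s
Pointwise-nth zero (p ∷ ps) refl = _ , refl , p
Pointwise-nth (suc n) (p ∷ ps) e = Pointwise-nth n ps e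

Pointwise-nth⁻ : ∀ {R : Row → Row → Set} {xs ys} n {s} → Pointwise R xs ys → nth ys n ≡ just s →
                 ∃ λ r → nth xs n ≡ just r × R r s
Pointwise-nth⁻ zero (p ∷ ps) refl = _ , refl , p
Pointwise-nth⁻ (suc n) (p ∷ ps) e = Pointwise-nth⁻ n ps e

All-nth : ∀ {P : Row → Set} T n {r} → All P T → nth T n ≡ just r → P r
All-nth (x ∷ T) zero (p ∷ ps) refl = p
All-nth (x ∷ T) (suc n) (p ∷ ps) e = All-nth T n ps e

FrameAt : ℕ → ℕ → ℕ → Row → Row → ℕ → Set
FrameAt lo hi x r r' j = nth r' j ≡ nth r j ⊎ (lo ≤ j × j ≤ hi × ∃ λ v → nth r' j ≡ just v × v ≤ x)

record Frame (lo hi x : ℕ) (r r' : Row) : Set where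
  constructor frame
  field frameAt : ∀ j → FrameAt lo hi x r r' j
open Frame public

Frame-refl : ∀ {lo hi x r} → Frame lo hi x r r
Frame-refl = frame λ j → inj₁ refl

Frame-trans : ∀ {a b x a' b' x' a'' b'' r r' r''} → a'' ≤ a → a'' ≤ a' → b ≤ b'' → b' ≤ b'' → x' ≤ x →
              Frame a b x r r' → Frame a' b' x' r' r'' → Frame a'' b'' x r r''
Frame-trans {a} {b} {x} {a'} {b'} {x'} {a''} {b''} {r} {r'} {r''} h₁ h₂ h₃ h₄ h₅ (frame f) (frame g) =
  frame λ j → compose (f j) (g j)
  where
  compose : ∀ {j} → FrameAt a b x r r' j → FrameAt a' b' x' r' r'' j → FrameAt a'' b'' x r r'' j
  compose (inj₁ e₁) (inj₁ e₂) = inj₁ (trans e₂ e₁)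
  compose (inj₂ (p , q , v , e , le)) (inj₁ e₂) = inj₂ (≤-trans h₁ p , ≤-trans q h₃ , v , trans e₂ e , le)
  compose _ (inj₂ (p , q , v , e , le)) = inj₂ (≤-trans h₂ p , ≤-trans q h₄ , v , e , ≤-trans le h₅)

Frame-weaken : ∀ {lo hi x lo' hi' x' r r'} → lo' ≤ lo → hi ≤ hi' → x ≤ x' →
               Frame lo hi x r r' → Frame lo' hi' x' r r'
Frame-weaken {lo} {hi} {x} {lo'} {hi'} {x'} {r} {r'} a b c (frame f) = frame λ j → weaken (f j)
  where
  weaken : ∀ {j} → FrameAt lo hi x r r' j → FrameAt lo' hi' x' r r' j
  weaken (inj₁ e) = inj₁ e
  weaken (inj₂ (p , q , v , e , l)) = inj₂ (≤-trans a p , ≤-trans q b , v , e , ≤-trans l c)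

Frame-outside : ∀ {lo hi x r r'} j → Frame lo hi x r r' → (hi < j ⊎ j < lo) → nth r' j ≡ nth r j
Frame-outside j (frame f) o with f j | o
... | inj₁ e | _ = e
... | inj₂ (_ , q , _) | inj₁ lt = ⊥-elim (<⇒≱ lt q)
... | inj₂ (p , _ , _) | inj₂ lt = ⊥-elim (<⇒≱ lt p)

Frame-inside : ∀ {lo k x rb rt t} → Frame lo k x rb rt → nth rt k ≡ just t → nth rb k ≡ just t ⊎ t ≤ x
Frame-inside {k = k} (frame f) e with f k
... | inj₁ e' = inj₁ (trans (sym e') e)
... | inj₂ (_ , _ , v , e' , le) with trans (sym e) e'
...   | refl = inj₂ le

Frame-replaceAt : ∀ r q x {y} → nth r q ≡ just y → Frame q q x r (replaceAt r q x)
Frame-replaceAt r q x e = frame at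
  where
  at : ∀ j → FrameAt q q x r (replaceAt r q x) j
  at j with j ≟ q
  ... | yes refl = inj₂ (≤-refl , ≤-refl , x , nth-replaceAt-≡ r q x e , ≤-refl)
  ... | no ne = inj₁ (nth-replaceAt-≢ r q x j ne)

Frame-append : ∀ r x → Frame (length r) (length r) x r (r ++ [ x ])
Frame-append r x = frame at
  where
  at : ∀ j → FrameAt (length r) (length r) x r (r ++ [ x ]) j
  at j with j ≟ length r
  ... | yes refl = inj₂ (≤-refl , ≤-refl , x , nth-append-≡ r x , ≤-refl)
  ... | no ne = inj₁ (nth-append-≢ r x j ne)

scan-frame : ∀ k i x V → Pointwise (Frame (suc k) (suc k) x) V (resTab (scanCol (suc k) i x V))
scan-frame k i x [] = []
scan-frame k i x (r ∷ V) with stepRow (suc k) x r | stepView k x r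
... | .(placed _) | placed _ _ _ _ len =
  subst (λ q → Frame q q x r (r ++ [ x ])) len (Frame-append r x) ∷ Pointwise.refl Frame-refl
... | .(bumped _ y) | bumped _ y _ _ e y≤x =
  subst (Pointwise _ (r ∷ V)) (sym (resTab-consBump _ _ (scanCol (suc k) (suc i) y V)))
    (Frame-replaceAt r (suc k) x e ∷ Pointwise.map (Frame-weaken ≤-refl ≤-refl y≤x) (scan-frame k (suc i) y V))
... | .skip | skip _ =
  subst (Pointwise _ (r ∷ V)) (sym (resTab-consRow _ (scanCol (suc k) (suc i) x V)))
    (Frame-refl ∷ scan-frame k (suc i) x V)

record Decreasing (r : Row) : Set where
  constructor decreasing
  field decreases : ∀ j u v → nth r j ≡ just u → nth r (suc j) ≡ just v → v < u
open Decreasing public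

Decreasing-mono : ∀ r → Decreasing r → ∀ j j' v → j ≤ j' → nth r j' ≡ just v → ∃ λ u → nth r j ≡ just u × v ≤ u
Decreasing-mono r s j j' v le e with m≤n⇒m<n∨m≡n le
... | inj₂ refl = v , e , ≤-refl
Decreasing-mono r s j (suc j') v le e | inj₁ (s≤s lt) with nth-pred r j' e
... | u' , e' with Decreasing-mono r s j j' u' lt e'
...   | u , eu , le' = u , eu , ≤-trans (<⇒≤ (decreases s j' u' v e' e)) le'

Decreasing-order : ∀ r → Decreasing r → ∀ {s k h l} → s ≤ k → nth r s ≡ just h → nth r k ≡ just l → l ≤ h
Decreasing-order r dec {s} {k} {h} {l} s≤k es ek with Decreasing-mono r dec s k l s≤k ek
... | u , eu , l≤u with trans (sym es) eu
...   | refl = l≤u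

Decreasing-update : ∀ r r' k x → Decreasing r → (∀ j → j ≢ suc k → nth r' j ≡ nth r j) → nth r' (suc k) ≡ just x →
                    (∀ l → nth r k ≡ just l → x < l) → (∀ v → nth r (suc (suc k)) ≡ just v → v < x) → Decreasing r'
Decreasing-update r r' k x (decreasing s) same at lt gt = decreasing dec
  where
  dec : ∀ j u v → nth r' j ≡ just u → nth r' (suc j) ≡ just v → v < u
  dec j u v e₁ e₂ with j ≟ suc k
  ... | yes refl with trans (sym at) e₁
  ...   | refl = gt v (trans (sym (same (suc (suc k)) (λ ()))) e₂)
  dec j u v e₁ e₂ | no ne with j ≟ k
  ...   | yes refl with trans (sym at) e₂
  ...     | refl = lt u (trans (sym (same k (λ e → 1+n≢n (sym e)))) e₁)
  dec j u v e₁ e₂ | no ne | no ne₂ =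
    s j u v (trans (sym (same j ne)) e₁) (trans (sym (same (suc j) (λ e → ne₂ (suc-injective e)))) e₂)

Decreasing-append : ∀ r k x l → Decreasing r → nth r k ≡ just l → x < l → length r ≡ suc k → Decreasing (r ++ [ x ])
Decreasing-append r k x l s e₁ x<l len =
  Decreasing-update r (r ++ [ x ]) k x s (λ j ne → nth-append-≢ r x j (λ e → ne (trans e len)))
    (subst (λ q → nth (r ++ [ x ]) q ≡ just x) len (nth-append-≡ r x))
    (λ l' e → subst (x <_) (just-injective (trans (sym e₁) e)) x<l)
    (λ v e → ⊥-elim (just≢nothing (trans (sym e) (nth-beyond r (suc (suc k)) (≤-trans (≤-reflexive len) (n≤1+n _))))))

Decreasing-bump : ∀ r k x l y → Decreasing r → nth r k ≡ just l → x < l → nth r (suc k) ≡ just y → y ≤ x →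
                  Decreasing (replaceAt r (suc k) x)
Decreasing-bump r k x l y s e₁ x<l e₂ y≤x =
  Decreasing-update r (replaceAt r (suc k) x) k x s (nth-replaceAt-≢ r (suc k) x) (nth-replaceAt-≡ r (suc k) x e₂)
    (λ l' e → subst (x <_) (just-injective (trans (sym e₁) e)) x<l)
    (λ v e → <-≤-trans (decreases s (suc k) y v e₂ e) y≤x)

scan-decreasing : ∀ k i x V → All Decreasing V → All Decreasing (resTab (scanCol (suc k) i x V))
scan-decreasing k i x [] a = []
scan-decreasing k i x (r ∷ V) (sr ∷ a) with stepRow (suc k) x r | stepView k x r
... | .(placed _) | placed l e₁ x<l _ len = Decreasing-append r k x l sr e₁ x<l len ∷ a
... | .(bumped _ y) | bumped l y e₁ x<l e₂ y≤x =
  subst (All Decreasing) (sym (resTab-consBump _ _ (scanCol (suc k) (suc i) y V)))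
    (Decreasing-bump r k x l y sr e₁ x<l e₂ y≤x ∷ scan-decreasing k (suc i) y V a)
... | .skip | skip _ =
  subst (All Decreasing) (sym (resTab-consRow _ (scanCol (suc k) (suc i) x V))) (sr ∷ scan-decreasing k (suc i) x V a)

-- What a column scan records about each box where it placed an entry:
-- box (n+1, k+2) of a scan over the rows V (the first of which is row i+1)
-- lies in a row r of V whose new version holds an entry h ≤ x at that box,
-- the old entry there was absent or at most h, its left neighbour exceeds h,
-- and anything carried out of the scan is at most h.

EmptyOrAtMost : Row → ℕ → ℕ → Set
EmptyOrAtMost r j h = nth r j ≡ nothing ⊎ ∃ λ v → nth r j ≡ just v × v ≤ h

EmptyOrAtMost-transport : ∀ {r r₀ s h} → nth r s ≡ nth r₀ s → EmptyOrAtMost r s h → EmptyOrAtMost r₀ s h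
EmptyOrAtMost-transport e (inj₁ e₁) = inj₁ (trans (sym e) e₁)
EmptyOrAtMost-transport e (inj₂ (v , e₁ , l)) = inj₂ (v , trans (sym e) e₁ , l)

ScanBox : ℕ → ℕ → ℕ → Tab → ColRes → ℕ × ℕ → Set
ScanBox k i x V R (zero , j) = ⊥
ScanBox k i x V R (suc n , j) = j ≡ suc (suc k) × i ≤ n × ∃ λ r → ∃ λ r' → ∃ λ h →
  nth V (n ∸ i) ≡ just r × nth (resTab R) (n ∸ i) ≡ just r' × nth r' (suc k) ≡ just h × h ≤ x ×
  carried R ≤ h × EmptyOrAtMost r (suc k) h × ∃ λ l → nth r k ≡ just l × h < l

ScanBox-column : ∀ {k i x V R n j} → ScanBox k i x V R (n , j) → j ≡ suc (suc k)
ScanBox-column {n = zero} ()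
ScanBox-column {n = suc n} (e , _) = e

nth-diag : ∀ {A : Set} i (a : A) as → nth (a ∷ as) (i ∸ i) ≡ just a
nth-diag i a as rewrite n∸n≡0 i = refl

nth-offset : ∀ {A : Set} (a : A) as n i → i < n → nth (a ∷ as) (n ∸ i) ≡ nth as (n ∸ suc i)
nth-offset a as n i i<n rewrite +-∸-assoc 1 i<n = refl

ScanBox-here : ∀ {k i x r V T r' h l} R → resTab R ≡ r' ∷ T → nth r' (suc k) ≡ just h → h ≤ x → carried R ≤ h →
               EmptyOrAtMost r (suc k) h → nth r k ≡ just l → h < l → ScanBox k i x (r ∷ V) R (suc i , suc (suc k))
ScanBox-here {i = i} {r = r} {V} {T} {r'} {h} {l} R eq e hx c rd el hl =
  refl , ≤-refl , r , r' , h , nth-diag i r V , subst (λ U → nth U (i ∸ i) ≡ just r') (sym eq) (nth-diag i r' T) ,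
  e , hx , c , rd , l , el , hl

ScanBox-tail : ∀ {k i x y r r' V} R R' → y ≤ x → resTab R' ≡ r' ∷ resTab R → carried R' ≡ carried R →
               ∀ {b} → ScanBox k (suc i) y V R b → ScanBox k i x (r ∷ V) R' b
ScanBox-tail R R' y≤x eT ec {zero , j} ()
ScanBox-tail {i = i} {r = r} {r'} {V} R R' y≤x eT ec {suc n , j} (ej , le , r₀ , r₀' , h , e₁ , e₂ , e₃ , hy , c , rd , lft) =
  ej , ≤-trans (n≤1+n i) le , r₀ , r₀' , h , trans (nth-offset r V n i le) e₁ ,
  trans (cong (λ U → nth U (n ∸ i)) eT) (trans (nth-offset r' (resTab R) n i le) e₂) ,
  e₃ , ≤-trans hy y≤x , subst (_≤ h) (sym ec) c , rd , lft

scan-box : ∀ k i x V → All (ScanBox k i x V (scanCol (suc k) i x V)) (boxes (scanCol (suc k) i x V))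
scan-box k i x [] = []
scan-box k i x (r ∷ V) with stepRow (suc k) x r | stepView k x r
... | .(placed _) | placed l e₁ x<l e₂ len =
  ScanBox-here (stop ((r ++ [ x ]) ∷ V) [] (suc i , suc (suc k))) refl
    (subst (λ q → nth (r ++ [ x ]) q ≡ just x) len (nth-append-≡ r x))
    ≤-refl z≤n (inj₁ e₂) e₁ x<l ∷ []
... | .(bumped _ y) | bumped l y e₁ x<l e₂ y≤x =
  boxes-consBump R
    (ScanBox-here R' (resTab-consBump r' b R) (nth-replaceAt-≡ r (suc k) x e₂) ≤-refl
       (subst (_≤ x) (sym (carried-consBump r' b R)) (≤-trans (scan-carried k (suc i) y V) y≤x))
       (inj₂ (y , e₂ , y≤x)) e₁ x<l)
    (All.map (ScanBox-tail R R' y≤x (resTab-consBump r' b R) (carried-consBump r' b R)) (scan-box k (suc i) y V))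
  where
  R = scanCol (suc k) (suc i) y V
  r' = replaceAt r (suc k) x
  b = (suc i , suc (suc k))
  R' = consBump r' b R
... | .skip | skip _ =
  boxes-consRow R (All.map (ScanBox-tail R (consRow r R) ≤-refl (resTab-consRow r R) (carried-consRow r R))
                           (scan-box k (suc i) x V))
  where
  R = scanCol (suc k) (suc i) x V

-- A sweep over the columns at positions d+k, …, d+1 (right to left): the
-- insertion algorithm restricted to those columns.  The algorithm itself
-- is the sweep with d = 0 (insCols≡sweep); splitting off the last column
-- (sweep-split) lets a sweep be compared with one shifted by a column.

andThen : (ℕ → Tab → ColRes) → ColRes → ColRes
andThen f (stop T ps B) = stop T ps B
andThen f (go T ps y) = addBumps ps (f y T)

sweep : ℕ → ℕ → ℕ → Tab → ColRes
sweep d zero x T = go T [] x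
sweep d (suc k) x T = andThen (sweep d k) (scanCol (suc (d + k)) 0 x T)

d+k<d+1+k : ∀ d k → suc (d + k) ≤ d + suc k
d+k<d+1+k d k = ≤-reflexive (sym (+-suc d k))

sweep-carried : ∀ d k x V → carried (sweep d k x V) ≤ x
sweep-carried d zero x V = ≤-refl
sweep-carried d (suc k) x V with scanCol (suc (d + k)) 0 x V | scan-carried (d + k) 0 x V
... | stop T ps B | _ = z≤n
... | go T ps y | m =
  subst (_≤ x) (sym (carried-addBumps ps (sweep d k y T))) (≤-trans (sweep-carried d k y T) m)

sweep-frame : ∀ d k x V → Pointwise (Frame (suc d) (d + k) x) V (resTab (sweep d k x V))
sweep-frame d zero x V = Pointwise.refl Frame-refl
sweep-frame d (suc k) x V with scanCol (suc (d + k)) 0 x V | scan-frame (d + k) 0 x V | scan-carried (d + k) 0 x V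
... | stop T ps B | f | m = Pointwise.map (Frame-weaken (s≤s (m≤m+n d k)) (d+k<d+1+k d k) ≤-refl) f
... | go T ps y | f | m =
  subst (Pointwise _ V) (sym (resTab-addBumps ps (sweep d k y T)))
    (Pointwise.transitive (Frame-trans (s≤s (m≤m+n d k)) ≤-refl (d+k<d+1+k d k) (≤-trans (n≤1+n _) (d+k<d+1+k d k)) m)
      f (sweep-frame d k y T))

sweep-decreasing : ∀ d k x V → All Decreasing V → All Decreasing (resTab (sweep d k x V))
sweep-decreasing d zero x V a = a
sweep-decreasing d (suc k) x V a with scanCol (suc (d + k)) 0 x V | scan-decreasing (d + k) 0 x V a
... | stop T ps B | s = s
... | go T ps y | s = subst (All Decreasing) (sym (resTab-addBumps ps (sweep d k y T))) (sweep-decreasing d k y T s)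

SweepBox : ℕ → ℕ → ℕ → Tab → ColRes → ℕ × ℕ → Set
SweepBox d k x V R (zero , _) = ⊥
SweepBox d k x V R (suc n , zero) = ⊥
SweepBox d k x V R (suc n , suc s) = suc d ≤ s × s ≤ d + k × ∃ λ r → ∃ λ r' → ∃ λ h →
  nth V n ≡ just r × nth (resTab R) n ≡ just r' × nth r' s ≡ just h × h ≤ x × carried R ≤ h × EmptyOrAtMost r s h

SweepBox-column≤ : ∀ {d k x V R n j} → SweepBox d k x V R (n , j) → j ≤ suc (d + k)
SweepBox-column≤ {n = zero} ()
SweepBox-column≤ {n = suc n} {zero} ()
SweepBox-column≤ {n = suc n} {suc s} (_ , le , _) = s≤s le

SweepBox-column≥ : ∀ {d k x V R n j} → SweepBox d k x V R (n , j) → suc (suc d) ≤ j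
SweepBox-column≥ {n = zero} ()
SweepBox-column≥ {n = suc n} {zero} ()
SweepBox-column≥ {n = suc n} {suc s} (le , _) = s≤s le

sweep-box : ∀ d k x V → All (SweepBox d k x V (sweep d k x V)) (boxes (sweep d k x V))
sweep-box d zero x V = []
sweep-box d (suc k) x V with scanCol (suc (d + k)) 0 x V | scan-box (d + k) 0 x V | scan-frame (d + k) 0 x V
                            | scan-carried (d + k) 0 x V
... | stop T ps B | sb | f | m = All.map fromScan sb
  where
  fromScan : ∀ {b} → ScanBox (d + k) 0 x V (stop T ps B) b → SweepBox d (suc k) x V (stop T ps B) b
  fromScan {zero , j} ()
  fromScan {suc n , .(suc (suc (d + k)))} (refl , _ , r , r' , h , e₁ , e₂ , e₃ , hx , c , rd , _) =
    s≤s (m≤m+n d k) , d+k<d+1+k d k , r , r' , h , e₁ , e₂ , e₃ , hx , c , rd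
... | go T ps y | sb | f | m =
  subst (All (SweepBox d (suc k) x V (addBumps ps R))) (sym (boxes-addBumps ps R))
    (All.++⁺ (All.map fromScan sb) (All.map fromRest (sweep-box d k y T)))
  where
  R = sweep d k y T
  fromScan : ∀ {b} → ScanBox (d + k) 0 x V (go T ps y) b → SweepBox d (suc k) x V (addBumps ps R) b
  fromScan {zero , j} ()
  fromScan {suc n , .(suc (suc (d + k)))} (refl , _ , r , r' , h , e₁ , e₂ , e₃ , hx , c , rd , _)
    with Pointwise-nth n (sweep-frame d k y T) e₂
  ... | r'' , e₄ , fr =
    s≤s (m≤m+n d k) , d+k<d+1+k d k , r , r'' , h , e₁ , trans (cong (λ U → nth U n) (resTab-addBumps ps R)) e₄ ,
    trans (Frame-outside (suc (d + k)) fr (inj₁ ≤-refl)) e₃ , hx ,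
    subst (_≤ h) (sym (carried-addBumps ps R)) (≤-trans (sweep-carried d k y T) c) , rd
  fromRest : ∀ {b} → SweepBox d k y T R b → SweepBox d (suc k) x V (addBumps ps R) b
  fromRest {zero , _} ()
  fromRest {suc n , zero} ()
  fromRest {suc n , suc s} (p₁ , p₂ , r , r' , h , e₁ , e₂ , e₃ , hy , c , rd) with Pointwise-nth⁻ n f e₁
  ... | r₀ , e₀ , fr₀ =
    p₁ , ≤-trans p₂ (≤-trans (n≤1+n _) (d+k<d+1+k d k)) , r₀ , r' , h , e₀ ,
    trans (cong (λ U → nth U n) (resTab-addBumps ps R)) e₂ , e₃ , ≤-trans hy m ,
    subst (_≤ h) (sym (carried-addBumps ps R)) c ,
    EmptyOrAtMost-transport {r} {r₀} {s} (Frame-outside s fr₀ (inj₂ (s≤s p₂))) rd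

-- Column of the final box (1 if the sweep continues to a new row).
finalColumn : ColRes → ℕ
finalColumn (stop _ _ (_ , j)) = j
finalColumn (go _ _ _) = 1

sweep-finalColumn : ∀ d k x V → finalColumn (sweep d k x V) ≤ suc (d + k)
sweep-finalColumn d k x V with sweep d k x V | sweep-box d k x V
... | stop T ps (n , j) | a = SweepBox-column≤ (All.lookup a (stop∈boxes T ps (n , j)))
... | go _ _ _ | _ = s≤s z≤n

addBumps-[] : ∀ R → addBumps [] R ≡ R
addBumps-[] (stop _ _ _) = refl
addBumps-[] (go _ _ _) = refl

addBumps-++ : ∀ ps qs R → addBumps ps (addBumps qs R) ≡ addBumps (ps ++ qs) R
addBumps-++ ps qs (stop T rs B) = cong (λ z → stop T z B) (sym (++-assoc ps qs rs))
addBumps-++ ps qs (go T rs y) = cong (λ z → go T z y) (sym (++-assoc ps qs rs))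

andThen-addBumps : ∀ f ps R → andThen f (addBumps ps R) ≡ addBumps ps (andThen f R)
andThen-addBumps f ps (stop _ _ _) = refl
andThen-addBumps f ps (go T qs y) = sym (addBumps-++ ps qs (f y T))

insCols≡sweep : ∀ k x T → insCols k x T ≡ sweep 0 k x T
insCols≡sweep zero x T = refl
insCols≡sweep (suc k) x T with scanCol (suc k) 0 x T
... | stop _ _ _ = refl
... | go T' ps y = cong (addBumps ps) (insCols≡sweep k y T')

sweep-split : ∀ d k x T → sweep d (suc k) x T ≡ andThen (sweep d 1) (sweep (suc d) k x T)
sweep-split d zero x T = sym (addBumps-[] (sweep d 1 x T))
sweep-split d (suc k) x T rewrite +-suc d k with scanCol (suc (suc (d + k))) 0 x T
... | stop _ _ _ = refl
... | go T' ps y =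
  trans (cong (addBumps ps) (sweep-split d k y T')) (sym (andThen-addBumps (sweep d 1) ps (sweep (suc d) k y T')))

scan-beyond : ∀ k i x V → maxLen V ≤ k → scanCol (suc k) i x V ≡ go V [] x
scan-beyond k i x [] _ = refl
scan-beyond k i x (r ∷ V) le with stepRow (suc k) x r | stepView k x r
... | .(placed _) | placed l e₁ _ _ _ = ⊥-elim (just≢nothing (trans (sym e₁) (nth-beyond r k (≤-trans (m≤m⊔n _ _) le))))
... | .(bumped _ y) | bumped l y e₁ _ _ _ = ⊥-elim (just≢nothing (trans (sym e₁) (nth-beyond r k (≤-trans (m≤m⊔n _ _) le))))
... | .skip | skip _ = cong (consRow r) (scan-beyond k (suc i) x V (≤-trans (m≤n⊔m (length r) _) le))

insCols-from : ∀ k x V → maxLen V ≤ k → insCols k x V ≡ insCols (maxLen V) x V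
insCols-from k x V le with m≤n⇒m<n∨m≡n le
... | inj₂ e = cong (λ m → insCols m x V) (sym e)
insCols-from (suc k) x V le | inj₁ (s≤s le') = trans dropColumn (insCols-from k x V le')
  where
  dropColumn : insCols (suc k) x V ≡ insCols k x V
  dropColumn rewrite scan-beyond k 0 x V le' = addBumps-[] (insCols k x V)

insertRow : ℕ → ℕ → Tab → Tab
insertRow p y L = take p L ++ [ y ] ∷ drop p L

fromSweep : ColRes → InsResult
fromSweep (stop T ps B) = record { tab = T ; newBox = B ; path = ps ++ [ B ] ; rowMap = id }
fromSweep (go T ps y) =
  let p = newRowPos y T in
  record { tab    = insertRow p y T
         ; newBox = (suc p , 1)
         ; path   = map (shiftBox p) ps ++ [ (suc p , 1) ]
         ; rowMap = shiftRow p }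

insert≡fromSweep : ∀ U b → insert U b ≡ fromSweep (insCols (maxLen U) b U)
insert≡fromSweep U b with insCols (maxLen U) b U
... | stop _ _ _ = refl
... | go _ _ _ = refl

insCols≡sweep-from : ∀ N x V → maxLen V ≤ N → insCols (maxLen V) x V ≡ sweep 0 N x V
insCols≡sweep-from N x V le = trans (sym (insCols-from N x V le)) (insCols≡sweep N x V)

-- If the insertion adds a new row [y], a later insertion
-- into the enlarged tableau behaves as the insertion into the tableau
-- without that row, provided it never examines [y] with an entry smaller
-- than y in hand; only the row indices of its boxes shift.

mapBoxes : (ℕ × ℕ → ℕ × ℕ) → ColRes → ColRes
mapBoxes f (stop T ps B) = stop T (map f ps) (f B)
mapBoxes f (go T ps x) = go T (map f ps) x

shiftResult : ℕ → ℕ → ℕ → ColRes → ColRes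
shiftResult p s y (stop T ps B) = stop (insertRow p y T) (map (shiftBox s) ps) (shiftBox s B)
shiftResult p s y (go T ps x) = go (insertRow p y T) (map (shiftBox s) ps) x

mapBoxes-consBump : ∀ f r b R → mapBoxes f (consBump r b R) ≡ consBump r (f b) (mapBoxes f R)
mapBoxes-consBump f r b (stop _ _ _) = refl
mapBoxes-consBump f r b (go _ _ _) = refl

mapBoxes-consRow : ∀ f r R → mapBoxes f (consRow r R) ≡ consRow r (mapBoxes f R)
mapBoxes-consRow f r (stop _ _ _) = refl
mapBoxes-consRow f r (go _ _ _) = refl

shiftResult-consBump : ∀ p s y r b R → shiftResult (suc p) s y (consBump r b R) ≡ consBump r (shiftBox s b) (shiftResult p s y R)
shiftResult-consBump p s y r b (stop _ _ _) = refl
shiftResult-consBump p s y r b (go _ _ _) = refl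

shiftResult-consRow : ∀ p s y r R → shiftResult (suc p) s y (consRow r R) ≡ consRow r (shiftResult p s y R)
shiftResult-consRow p s y r (stop _ _ _) = refl
shiftResult-consRow p s y r (go _ _ _) = refl

shiftResult-here : ∀ s y R → consRow [ y ] (mapBoxes (shiftBox s) R) ≡ shiftResult 0 s y R
shiftResult-here s y (stop _ _ _) = refl
shiftResult-here s y (go _ _ _) = refl

shiftResult-addBumps : ∀ p s y ps R → addBumps (map (shiftBox s) ps) (shiftResult p s y R) ≡ shiftResult p s y (addBumps ps R)
shiftResult-addBumps p s y ps (stop T qs B) = cong (λ z → stop (insertRow p y T) z (shiftBox s B)) (sym (map-++ (shiftBox s) ps qs))
shiftResult-addBumps p s y ps (go T qs x) = cong (λ z → go (insertRow p y T) z x) (sym (map-++ (shiftBox s) ps qs))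

shiftRow-≤ : ∀ {m s} → m ≤ s → shiftRow s m ≡ m
shiftRow-≤ {m} {s} m≤s with m ≤ᵇ s | ≤ᵇ-reflects-≤ m s
... | true | ofʸ _ = refl
... | false | ofⁿ m≰s = ⊥-elim (m≰s m≤s)

shiftRow-> : ∀ {m s} → s < m → shiftRow s m ≡ suc m
shiftRow-> {m} {s} s<m with m ≤ᵇ s | ≤ᵇ-reflects-≤ m s
... | true | ofʸ m≤s = ⊥-elim (<⇒≱ s<m m≤s)
... | false | ofⁿ _ = refl

scan-lower : ∀ k i z L f → (∀ n c → i ≤ n → f (suc n , c) ≡ (suc (suc n) , c)) →
             scanCol (suc k) (suc i) z L ≡ mapBoxes f (scanCol (suc k) i z L)
scan-lower k i z [] f hf = refl
scan-lower k i z (r ∷ L) f hf with stepRow (suc k) z r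
... | placed r' = cong (stop (r' ∷ L) []) (sym (hf i _ ≤-refl))
... | bumped r' h =
  trans (cong₂ (consBump r') (sym (hf i _ ≤-refl)) (scan-lower k (suc i) h L f (λ n c le → hf n c (≤-trans (n≤1+n i) le))))
        (sym (mapBoxes-consBump f r' _ (scanCol (suc k) (suc i) h L)))
... | skip =
  trans (cong (consRow r) (scan-lower k (suc i) z L f (λ n c le → hf n c (≤-trans (n≤1+n i) le))))
        (sym (mapBoxes-consRow f r (scanCol (suc k) (suc i) z L)))

CarriesAtLeast : ℕ → ColRes → Set
CarriesAtLeast y (stop _ _ _) = ⊥
CarriesAtLeast y (go _ _ z) = y ≤ z

CarriesAtLeast-consBump : ∀ {y r b} R → CarriesAtLeast y (consBump r b R) → CarriesAtLeast y R
CarriesAtLeast-consBump (go _ _ _) g = g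

CarriesAtLeast-consRow : ∀ {y r} R → CarriesAtLeast y (consRow r R) → CarriesAtLeast y R
CarriesAtLeast-consRow (go _ _ _) g = g

CarriesAtLeast-addBumps : ∀ {y} ps R → CarriesAtLeast y (addBumps ps R) → CarriesAtLeast y R
CarriesAtLeast-addBumps ps (go _ _ _) g = g

CarriesAtLeast-bound : ∀ {y z} R → CarriesAtLeast y R → carried R ≤ z → y ≤ z
CarriesAtLeast-bound (go _ _ _) g c = ≤-trans g c

singleton-skipped : ∀ k h y → (1 ≤ k ⊎ y ≤ h) → stepRow (suc k) h [ y ] ≡ skip
singleton-skipped (suc k) h y _ = refl
singleton-skipped zero h y (inj₂ y≤h) with h <ᵇ y | <ᵇ-reflects-< h y
... | true | ofʸ h<y = ⊥-elim (<⇒≱ h<y y≤h)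
... | false | ofⁿ _ = refl

scan-insertRow : ∀ k i z L p y → (1 ≤ k ⊎ CarriesAtLeast y (scanCol (suc k) i z L)) →
                 scanCol (suc k) i z (insertRow p y L) ≡ shiftResult p (i + p) y (scanCol (suc k) i z L)
scan-insertRow k i z L zero y cond
  rewrite singleton-skipped k z y (map₂ (λ g → CarriesAtLeast-bound _ g (scan-carried k i z L)) cond) =
  trans (cong (consRow [ y ]) (scan-lower k i z L (shiftBox (i + 0)) shifted)) (shiftResult-here (i + 0) y (scanCol (suc k) i z L))
  where
  shifted : ∀ n c → i ≤ n → shiftBox (i + 0) (suc n , c) ≡ (suc (suc n) , c)
  shifted n c le = cong (_, c) (shiftRow-> (s≤s (≤-trans (≤-reflexive (+-identityʳ i)) le)))
scan-insertRow k i z [] (suc p) y cond rewrite singleton-skipped k z y cond = refl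
scan-insertRow k i z (r ∷ L) (suc p) y cond with stepRow (suc k) z r
... | placed r' = cong (stop (r' ∷ insertRow p y L) []) (cong (_, suc (suc k)) (sym (shiftRow-≤ i+1≤i+1+p)))
  where i+1≤i+1+p = ≤-trans (s≤s (m≤m+n i p)) (≤-reflexive (sym (+-suc i p)))
... | bumped r' h = begin
    consBump r' (suc i , suc (suc k)) (scanCol (suc k) (suc i) h (insertRow p y L))
      ≡⟨ cong (consBump r' _) (scan-insertRow k (suc i) h L p y (map₂ (CarriesAtLeast-consBump R) cond)) ⟩
    consBump r' (suc i , suc (suc k)) (shiftResult p (suc i + p) y R)
      ≡⟨ cong₂ (λ q s → consBump r' (q , suc (suc k)) (shiftResult p s y R))
               (sym (shiftRow-≤ (≤-trans (s≤s (m≤m+n i p)) (≤-reflexive (sym (+-suc i p)))))) (sym (+-suc i p)) ⟩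
    consBump r' (shiftBox (i + suc p) (suc i , suc (suc k))) (shiftResult p (i + suc p) y R)
      ≡⟨ sym (shiftResult-consBump p (i + suc p) y r' _ R) ⟩
    shiftResult (suc p) (i + suc p) y (consBump r' (suc i , suc (suc k)) R) ∎
  where
  open ≡-Reasoning
  R = scanCol (suc k) (suc i) h L
... | skip = begin
    consRow r (scanCol (suc k) (suc i) z (insertRow p y L))
      ≡⟨ cong (consRow r) (scan-insertRow k (suc i) z L p y (map₂ (CarriesAtLeast-consRow R) cond)) ⟩
    consRow r (shiftResult p (suc i + p) y R)
      ≡⟨ cong (λ s → consRow r (shiftResult p s y R)) (sym (+-suc i p)) ⟩
    consRow r (shiftResult p (i + suc p) y R)
      ≡⟨ sym (shiftResult-consRow p (i + suc p) y r R) ⟩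
    shiftResult (suc p) (i + suc p) y (consRow r R) ∎
  where
  open ≡-Reasoning
  R = scanCol (suc k) (suc i) z L

sweep-insertRow : ∀ d k x L p y → (1 ≤ d ⊎ CarriesAtLeast y (sweep d k x L)) →
                  sweep d k x (insertRow p y L) ≡ shiftResult p p y (sweep d k x L)
sweep-insertRow d zero x L p y cond = refl
sweep-insertRow d (suc k) x L p y cond =
  trans (cong (andThen (sweep d k)) (scan-insertRow (d + k) 0 x L p y (scanCondition S cond))) (rest S cond)
  where
  S = scanCol (suc (d + k)) 0 x L
  scanCondition : ∀ R → (1 ≤ d ⊎ CarriesAtLeast y (andThen (sweep d k) R)) → (1 ≤ d + k ⊎ CarriesAtLeast y R)
  scanCondition R (inj₁ le) = inj₁ (≤-trans le (m≤m+n d k))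
  scanCondition (go L' ps x') (inj₂ g) =
    inj₂ (CarriesAtLeast-bound (sweep d k x' L') (CarriesAtLeast-addBumps ps _ g) (sweep-carried d k x' L'))
  rest : ∀ R → (1 ≤ d ⊎ CarriesAtLeast y (andThen (sweep d k) R)) →
         andThen (sweep d k) (shiftResult p p y R) ≡ shiftResult p p y (andThen (sweep d k) R)
  rest (stop _ _ _) _ = refl
  rest (go L' ps x') c =
    trans (cong (addBumps (map (shiftBox p) ps)) (sweep-insertRow d k x' L' p y (map₂ (CarriesAtLeast-addBumps ps _) c)))
          (shiftResult-addBumps p p y ps (sweep d k x' L'))

Stops : ColRes → Set
Stops (stop _ _ _) = ⊤
Stops (go _ _ _) = ⊥

Stops-consBump : ∀ {r b} R → Stops R → Stops (consBump r b R)
Stops-consBump (stop _ _ _) s = tt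

Stops-consRow : ∀ {r} R → Stops R → Stops (consRow r R)
Stops-consRow (stop _ _ _) s = tt

singleton-place : ∀ w y → w < y → stepRow 1 w [ y ] ≡ placed ([ y ] ++ [ w ])
singleton-place w y w<y with w <ᵇ y | <ᵇ-reflects-< w y
... | true | ofʸ _ = refl
... | false | ofⁿ w≮y = ⊥-elim (w≮y w<y)

scan-stopsAt : ∀ i w L p y → w < y → Stops (scanCol 1 i w (insertRow p y L))
scan-stopsAt i w L zero y w<y rewrite singleton-place w y w<y = tt
scan-stopsAt i w [] (suc p) y w<y rewrite singleton-place w y w<y = tt
scan-stopsAt i w (r ∷ L) (suc p) y w<y with stepRow 1 w r | stepView 0 w r
... | .(placed _) | placed _ _ _ _ _ = tt
... | .(bumped _ h) | bumped _ h _ _ _ h≤w =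
  Stops-consBump (scanCol 1 (suc i) h (insertRow p y L)) (scan-stopsAt (suc i) h L p y (≤-<-trans h≤w w<y))
... | .skip | skip _ = Stops-consRow (scanCol 1 (suc i) w (insertRow p y L)) (scan-stopsAt (suc i) w L p y w<y)

SameOutcome : ColRes → ColRes → Set
SameOutcome (stop _ _ _) (stop _ _ _) = ⊤
SameOutcome (go _ _ y) (go _ _ y') = y ≡ y'
SameOutcome _ _ = ⊥

consBump-outcome : ∀ r b R → SameOutcome R (consBump r b R)
consBump-outcome r b (stop _ _ _) = tt
consBump-outcome r b (go _ _ _) = refl

consRow-outcome : ∀ r R → SameOutcome R (consRow r R)
consRow-outcome r (stop _ _ _) = tt
consRow-outcome r (go _ _ _) = refl

-- Row t of the tableau after inserting b agrees with row c (of the tableau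
-- being scanned while inserting c) at positions 0 … k.
record AgreeUpTo (k : ℕ) (c t : Row) : Set where
  constructor agree
  field agrees : ∀ j → j ≤ k → nth c j ≡ nth t j
open AgreeUpTo public

AgreeUpTo-refl : ∀ {k r} → AgreeUpTo k r r
AgreeUpTo-refl = agree λ j _ → refl

AgreeUpTo-afterScan : ∀ {k z c c' t} → Frame (suc k) (suc k) z c c' → AgreeUpTo (suc k) c t → AgreeUpTo k c' t
AgreeUpTo-afterScan {k} f (agree a) = agree λ j le → trans (Frame-outside j f (inj₂ (s≤s le))) (a j (≤-trans le (n≤1+n k)))

AgreeUpTo-afterScans : ∀ {k z C C' T} → Pointwise (Frame (suc k) (suc k) z) C C' → Pointwise (AgreeUpTo (suc k)) C T →
                       Pointwise (AgreeUpTo k) C' T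
AgreeUpTo-afterScans f a =
  Pointwise.transitive AgreeUpTo-afterScan (Pointwise.symmetric id f) a

readNext : ∀ {lo k X rb' rt rc} → Frame lo k X rb' rt → AgreeUpTo (suc k) rc rt → nth rc (suc k) ≡ nth rb' (suc k)
readNext {k = k} fr (agree a) = trans (a (suc k) ≤-refl) (Frame-outside (suc k) fr (inj₁ ≤-refl))

readLeft : ∀ {lo k X rb' rt rc l} → Frame lo k X rb' rt → AgreeUpTo (suc k) rc rt → nth rc k ≡ just l → X < l →
           nth rb' k ≡ just l
readLeft {k = k} fr (agree a) e X<l with Frame-inside fr (trans (sym (a k (n≤1+n k))) e)
... | inj₁ e' = e'
... | inj₂ l≤X = ⊥-elim (<⇒≱ X<l l≤X)

skip-next : ∀ {k x rb l} → Skip k x rb → nth rb k ≡ just l → x < l → ∃ λ y → nth rb (suc k) ≡ just y × x < y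
skip-next (inj₁ e) el x<l = ⊥-elim (just≢nothing (trans (sym el) e))
skip-next (inj₂ (inj₁ (l' , e , l'≤x))) el x<l with trans (sym el) e
... | refl = ⊥-elim (<⇒≱ x<l l'≤x)
skip-next (inj₂ (inj₂ (_ , y , _ , _ , e , x<y))) el x<l = y , e , x<y

-- A box in a row of Ts (the first of which is row i+1) whose entry at
-- position k (column k+1) exceeds X; c's boxes in column k+2 are of this
-- kind.
LeftAbove : ℕ → ℕ → Tab → ℕ → ℕ × ℕ → Set
LeftAbove k i Ts X (zero , _) = ⊥
LeftAbove k i Ts X (suc n , j) = i ≤ n × ∃ λ r → ∃ λ l → nth Ts (n ∸ i) ≡ just r × nth r k ≡ just l × X < l

LeftAbove-here : ∀ {k i X rt Ts rc l} j → AgreeUpTo (suc k) rc rt → nth rc k ≡ just l → X < l →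
                 LeftAbove k i (rt ∷ Ts) X (suc i , j)
LeftAbove-here {k} {i} {rt = rt} {Ts} {l = l} j (agree a) e X<l =
  ≤-refl , rt , l , nth-diag i rt Ts , trans (sym (a k (n≤1+n k))) e , X<l

LeftAbove-tail : ∀ {k i rt Ts X} b → LeftAbove k (suc i) Ts X b → LeftAbove k i (rt ∷ Ts) X b
LeftAbove-tail (zero , _) ()
LeftAbove-tail {i = i} {rt} {Ts} (suc n , j) (le , r , l , e₁ , e₂ , lt) =
  ≤-trans (n≤1+n i) le , r , l , trans (nth-offset rt Ts n i le) e₁ , e₂ , lt

scan-leftPositive : ∀ k i z Cs Ts → Pointwise (AgreeUpTo (suc k)) Cs Ts →
                    All (LeftAbove k i Ts 0) (boxes (scanCol (suc k) i z Cs))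
scan-leftPositive k i z Cs Ts pw = All.map fromScan (scan-box k i z Cs)
  where
  fromScan : ∀ {b} → ScanBox k i z Cs (scanCol (suc k) i z Cs) b → LeftAbove k i Ts 0 b
  fromScan {zero , _} ()
  fromScan {suc n , j} (_ , le , r , _ , h , e₁ , _ , _ , _ , _ , _ , l , el , hl) with Pointwise-nth (n ∸ i) pw e₁
  ... | rt , et , agree a = le , rt , l , et , trans (sym (a k (n≤1+n k))) el , ≤-<-trans z≤n hl

FollowsC : ColRes → ColRes → Set
FollowsC (stop _ _ _) _ = ⊤
FollowsC (go _ _ y) Rc = CarriesAtLeast y Rc

FollowsC-resp : ∀ Rb Rb' Rc Rc' → SameOutcome Rb Rb' → SameOutcome Rc Rc' → FollowsC Rb Rc → FollowsC Rb' Rc'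
FollowsC-resp (stop _ _ _) (stop _ _ _) _ _ _ _ _ = tt
FollowsC-resp (go _ _ y) (go _ _ .y) (go _ _ z) (go _ _ .z) refl refl f = f

Pointwise-∷-[] : ∀ {R : Row → Row → Set} {r T} → Pointwise R (r ∷ T) [] → ⊥
Pointwise-∷-[] ()

scan-nonempty : ∀ {R : Row → Row → Set} k i x r V → Pointwise R (resTab (scanCol (suc k) i x (r ∷ V))) [] → ⊥
scan-nonempty {R} k i x r V p with stepRow (suc k) x r
... | placed _ = Pointwise-∷-[] p
... | bumped r' y = Pointwise-∷-[] (subst (λ U → Pointwise R U []) (resTab-consBump r' _ (scanCol (suc k) (suc i) y V)) p)
... | skip = Pointwise-∷-[] (subst (λ U → Pointwise R U []) (resTab-consRow r (scanCol (suc k) (suc i) x V)) p)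

ComparedC : ℕ → ℕ → ℕ → Tab → ColRes → ColRes → Set
ComparedC k i X Ts Rb Rc = FollowsC Rb Rc × All (LeftAbove k i Ts X) (boxes Rc)

-- c's step on a row where c finds an entry x at position k+1 (which b has
-- just written there): c bumps x or skips, and carries on at least x.
scanC-afterBump : ∀ k i x z X rc Cs rt Ts R Rb → SameOutcome R Rb → x ≤ z → X ≤ x → nth rc (suc k) ≡ just x →
                  AgreeUpTo (suc k) rc rt → (∀ z' → x ≤ z' → ComparedC k (suc i) X Ts R (scanCol (suc k) (suc i) z' Cs)) →
                  ComparedC k i X (rt ∷ Ts) Rb (scanCol (suc k) i z (rc ∷ Cs))
scanC-afterBump k i x z X rc Cs rt Ts R Rb same x≤z X≤x rcNext ag ih with stepRow (suc k) z rc | stepView k z rc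
... | .(placed _) | placed _ _ _ c₂ _ = ⊥-elim (just≢nothing (trans (sym rcNext) c₂))
... | .(bumped _ y') | bumped l' y' c₁ z<l' c₂ _ with just-injective (trans (sym c₂) rcNext)
...   | refl =
  FollowsC-resp R Rb Rc _ same (consBump-outcome _ _ Rc) (proj₁ (ih y' ≤-refl)) ,
  boxes-consBump Rc (LeftAbove-here (suc (suc k)) ag c₁ (≤-<-trans X≤x (≤-<-trans x≤z z<l')))
    (All.map (LeftAbove-tail _) (proj₂ (ih y' ≤-refl)))
  where Rc = scanCol (suc k) (suc i) y' Cs
scanC-afterBump k i x z X rc Cs rt Ts R Rb same x≤z X≤x rcNext ag ih | .skip | skip _ =
  FollowsC-resp R Rb Rc _ same (consRow-outcome _ Rc) (proj₁ (ih z x≤z)) ,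
  boxes-consRow Rc (All.map (LeftAbove-tail _) (proj₂ (ih z x≤z)))
  where Rc = scanCol (suc k) (suc i) z Cs

-- c's step on a row that b skipped with x in hand: c cannot place there,
-- and if it bumps, it bumps an entry larger than x.
scanC-afterSkip : ∀ k i x z X lo rb rc Cs rt Ts R Rb → SameOutcome R Rb → Skip k x rb → x ≤ z → X ≤ x →
                  Frame lo k X rb rt → AgreeUpTo (suc k) rc rt →
                  (∀ z' → x ≤ z' → ComparedC k (suc i) X Ts R (scanCol (suc k) (suc i) z' Cs)) →
                  ComparedC k i X (rt ∷ Ts) Rb (scanCol (suc k) i z (rc ∷ Cs))
scanC-afterSkip k i x z X lo rb rc Cs rt Ts R Rb same sk x≤z X≤x fr ag ih with stepRow (suc k) z rc | stepView k z rc
... | .(placed _) | placed l' c₁ z<l' c₂ _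
  with skip-next {rb = rb} sk (readLeft fr ag c₁ (≤-<-trans X≤x (≤-<-trans x≤z z<l'))) (≤-<-trans x≤z z<l')
...   | _ , e , _ = ⊥-elim (just≢nothing (trans (sym e) (trans (sym (readNext fr ag)) c₂)))
scanC-afterSkip k i x z X lo rb rc Cs rt Ts R Rb same sk x≤z X≤x fr ag ih | .(bumped _ y') | bumped l' y' c₁ z<l' c₂ _
  with skip-next {rb = rb} sk (readLeft fr ag c₁ (≤-<-trans X≤x (≤-<-trans x≤z z<l'))) (≤-<-trans x≤z z<l')
...   | _ , e , x<v with trans (sym e) (trans (sym (readNext fr ag)) c₂)
...     | refl =
  FollowsC-resp R Rb Rc _ same (consBump-outcome _ _ Rc) (proj₁ (ih y' (<⇒≤ x<v))) ,
  boxes-consBump Rc (LeftAbove-here (suc (suc k)) ag c₁ (≤-<-trans X≤x (≤-<-trans x≤z z<l')))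
    (All.map (LeftAbove-tail _) (proj₂ (ih y' (<⇒≤ x<v))))
  where Rc = scanCol (suc k) (suc i) y' Cs
scanC-afterSkip k i x z X lo rb rc Cs rt Ts R Rb same sk x≤z X≤x fr ag ih | .skip | skip _ =
  FollowsC-resp R Rb Rc _ same (consRow-outcome _ Rc) (proj₁ (ih z x≤z)) ,
  boxes-consRow Rc (All.map (LeftAbove-tail _) (proj₂ (ih z x≤z)))
  where Rc = scanCol (suc k) (suc i) z Cs

-- Invariants: b's scan starts with x, c's
-- with z ≥ x; b's rows after the scan differ from T only at positions ≤ k
-- by entries ≤ X (the later columns of b's insertion), where X is at most
-- what b carries on; c's rows agree with T up to position k+1.
scanC : ∀ k i x z X lo Bs Cs Ts → x ≤ z → X ≤ carried (scanCol (suc k) i x Bs) →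
        Pointwise (Frame lo k X) (resTab (scanCol (suc k) i x Bs)) Ts → Pointwise (AgreeUpTo (suc k)) Cs Ts →
        ComparedC k i X Ts (scanCol (suc k) i x Bs) (scanCol (suc k) i z Cs)
scanC k i x z X lo [] [] [] x≤z _ _ _ = x≤z , []
scanC k i x z X lo (rb ∷ Bs) [] [] _ _ pf [] = ⊥-elim (scan-nonempty k i x rb Bs pf)
scanC k i x z X lo (rb ∷ Bs) (rc ∷ Cs) (rt ∷ Ts) x≤z X≤ pf (ag ∷ pa) with stepRow (suc k) x rb | stepView k x rb
... | .(placed _) | placed _ _ _ _ _ with X≤
...   | z≤n = tt , scan-leftPositive k i z (rc ∷ Cs) (rt ∷ Ts) (ag ∷ pa)
scanC k i x z X lo (rb ∷ Bs) (rc ∷ Cs) (rt ∷ Ts) x≤z X≤ pf (ag ∷ pa) | .(bumped _ y) | bumped l y e₁ x<l e₂ y≤x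
  with subst (λ U → Pointwise (Frame lo k X) U (rt ∷ Ts)) (resTab-consBump _ _ (scanCol (suc k) (suc i) y Bs)) pf
...   | fr ∷ pfs =
  scanC-afterBump k i x z X rc Cs rt Ts R _ (consBump-outcome _ _ R) x≤z
    (≤-trans X≤R (≤-trans (scan-carried k (suc i) y Bs) y≤x)) (trans (readNext fr ag) (nth-replaceAt-≡ rb (suc k) x e₂)) ag
    (λ z' x≤z' → scanC k (suc i) y z' X lo Bs Cs Ts (≤-trans y≤x x≤z') X≤R pfs pa)
  where
  R = scanCol (suc k) (suc i) y Bs
  X≤R = subst (X ≤_) (carried-consBump _ _ R) X≤
scanC k i x z X lo (rb ∷ Bs) (rc ∷ Cs) (rt ∷ Ts) x≤z X≤ pf (ag ∷ pa) | .skip | skip sk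
  with subst (λ U → Pointwise (Frame lo k X) U (rt ∷ Ts)) (resTab-consRow _ (scanCol (suc k) (suc i) x Bs)) pf
...   | fr ∷ pfs =
  scanC-afterSkip k i x z X lo rb rc Cs rt Ts R _ (consRow-outcome _ R) sk x≤z (≤-trans X≤R (scan-carried k (suc i) x Bs)) fr ag
    (λ z' x≤z' → scanC k (suc i) x z' X lo Bs Cs Ts x≤z' X≤R pfs pa)
  where
  R = scanCol (suc k) (suc i) x Bs
  X≤R = subst (X ≤_) (carried-consRow _ R) X≤

EndC : ColRes → ColRes → Set
EndC (stop _ _ (_ , jb)) Rc = finalColumn Rc ≤ jb
EndC (go _ _ y) Rc = CarriesAtLeast y Rc

EndC-addBumps : ∀ ps ps' R R' → EndC R R' → EndC (addBumps ps R) (addBumps ps' R')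
EndC-addBumps ps ps' (stop _ _ _) (stop _ _ _) e = e
EndC-addBumps ps ps' (stop _ _ _) (go _ _ _) e = e
EndC-addBumps ps ps' (go _ _ _) (go _ _ _) e = e

RowwiseWeaklyLeft : List (ℕ × ℕ) → List (ℕ × ℕ) → Set
RowwiseWeaklyLeft Pb Pc = ∀ n j j' → (n , j) ∈ Pb → (n , j') ∈ Pc → j' ≤ j

ClaimC : ℕ → ℕ → ℕ → Tab → Tab → Set
ClaimC k x z B C = EndC (sweep 0 k x B) (sweep 0 k z C) × RowwiseWeaklyLeft (boxes (sweep 0 k x B)) (boxes (sweep 0 k z C))

sweepC-bStops : ∀ k z C TB ps nb → (∀ {b} → b ∈ ps ++ [ (nb , suc (suc k)) ] → proj₂ b ≡ suc (suc k)) →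
                EndC (stop TB ps (nb , suc (suc k))) (sweep 0 (suc k) z C) ×
                RowwiseWeaklyLeft (ps ++ [ (nb , suc (suc k)) ]) (boxes (sweep 0 (suc k) z C))
sweepC-bStops k z C TB ps nb column =
  sweep-finalColumn 0 (suc k) z C ,
  λ n j j' m m' → subst (j' ≤_) (sym (column m)) (SweepBox-column≤ (All.lookup (sweep-box 0 (suc k) z C) m'))

-- A later box of b (column s+1 ≤ k+1, entry h ≤ y) and a box of c in column
-- k+2 (left neighbour above y in T) cannot share a row of T, since rows of T
-- decrease.
laterBox-clash : ∀ k y TB T n j j' → T ≡ resTab (sweep 0 k y TB) → All Decreasing T →
                 SweepBox 0 k y TB (sweep 0 k y TB) (n , j) → LeftAbove k 0 T y (n , j') → ⊥
laterBox-clash k y TB T zero j j' eT dec () _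
laterBox-clash k y TB T (suc n) zero j' eT dec () _
laterBox-clash k y TB T (suc n) (suc s) j' eT dec (_ , s≤k , _ , r' , h , _ , e₂ , e₃ , h≤y , _) (_ , rt , l , et , el , y<l)
  with trans (sym et) (trans (cong (λ U → nth U n) eT) e₂)
... | refl = <⇒≱ y<l (≤-trans (Decreasing-order rt (All-nth T n dec et) s≤k e₃ el) h≤y)

sweepC-bGoes : ∀ k z C TB ps y T → T ≡ resTab (sweep 0 k y TB) → All Decreasing T →
               All (λ b → proj₂ b ≡ suc (suc k)) ps →
               CarriesAtLeast y (scanCol (suc k) 0 z C) → All (LeftAbove k 0 T y) (boxes (scanCol (suc k) 0 z C)) →
               (∀ z' C' → y ≤ z' → Pointwise (AgreeUpTo k) C' T → ClaimC k y z' TB C') →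
               Pointwise (AgreeUpTo (suc k)) C T →
               EndC (addBumps ps (sweep 0 k y TB)) (sweep 0 (suc k) z C) ×
               RowwiseWeaklyLeft (boxes (addBumps ps (sweep 0 k y TB))) (boxes (sweep 0 (suc k) z C))
sweepC-bGoes k z C TB ps y T eT dec colB carries above ih agr
  with scanCol (suc k) 0 z C | scan-box k 0 z C | scan-frame k 0 z C | carries | above
... | go TC ps' z' | sbC | frC | y≤z' | aboveC = EndC-addBumps ps ps' Fb Fc (proj₁ claim) , boxClaim
  where
  Fb = sweep 0 k y TB
  Fc = sweep 0 k z' TC
  claim = ih z' TC y≤z' (AgreeUpTo-afterScans frC agr)
  boxClaim : RowwiseWeaklyLeft (boxes (addBumps ps Fb)) (boxes (addBumps ps' Fc))
  boxClaim n j j' m m' with ∈-++⁻ ps (subst ((n , j) ∈_) (boxes-addBumps ps Fb) m)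
                          | ∈-++⁻ ps' (subst ((n , j') ∈_) (boxes-addBumps ps' Fc) m')
  ... | inj₁ mb | inj₁ mc = ≤-reflexive (trans (ScanBox-column (All.lookup sbC mc)) (sym (All.lookup colB mb)))
  ... | inj₁ mb | inj₂ mc =
    ≤-trans (SweepBox-column≤ (All.lookup (sweep-box 0 k z' TC) mc)) (≤-trans (n≤1+n _) (≤-reflexive (sym (All.lookup colB mb))))
  ... | inj₂ mb | inj₂ mc = proj₂ claim n j j' mb mc
  ... | inj₂ mb | inj₁ mc = ⊥-elim (laterBox-clash k y TB T n j j' eT dec (All.lookup (sweep-box 0 k y TB) mb) (All.lookup aboveC mc))

sweepC : ∀ k x z B C T → x ≤ z → T ≡ resTab (sweep 0 k x B) → Pointwise (AgreeUpTo k) C T → All Decreasing T →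
         ClaimC k x z B C
sweepC zero x z B C T x≤z eT agr dec = x≤z , λ n j j' ()
sweepC (suc k) x z B C T x≤z eT agr dec
  with scanCol (suc k) 0 x B | scan-box k 0 x B | (λ X lo → scanC k 0 x z X lo B C T)
... | stop TB ps (nb , jb) | sbB | _ with ScanBox-column (All.lookup sbB (stop∈boxes TB ps (nb , jb)))
...   | refl = sweepC-bStops k z C TB ps nb (λ m → ScanBox-column (All.lookup sbB m))
sweepC (suc k) x z B C T x≤z eT agr dec | go TB ps y | sbB | scan =
  sweepC-bGoes k z C TB ps y T eT' dec (All.map ScanBox-column sbB) (proj₁ compared) (proj₂ compared)
    (λ z' C' y≤z' agr' → sweepC k y z' TB C' T y≤z' eT' agr' dec) agr
  where
  eT' : T ≡ resTab (sweep 0 k y TB)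
  eT' = trans eT (resTab-addBumps ps (sweep 0 k y TB))
  compared = scan y 1 x≤z ≤-refl (subst (Pointwise (Frame 1 k y) TB) (sym eT') (sweep-frame 0 k y TB)) agr

-- Inserting a < b stays strictly ahead of b: a's scan of column k+3 is
-- compared with b's scan of column k+2.  If b stops, so does a; if b
-- carries y on, a carries on (if at all) an entry below y.

CarriesBelow : ℕ → ColRes → Set
CarriesBelow y (stop _ _ _) = ⊤
CarriesBelow y (go _ _ w) = w < y

AheadA : ColRes → ColRes → Set
AheadA (stop _ _ _) Ra = Stops Ra
AheadA (go _ _ y) Ra = CarriesBelow y Ra

AheadA-resp : ∀ Rb Rb' Ra Ra' → SameOutcome Rb Rb' → SameOutcome Ra Ra' → AheadA Rb Ra → AheadA Rb' Ra'
AheadA-resp (stop _ _ _) (stop _ _ _) (stop _ _ _) (stop _ _ _) _ _ _ = tt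
AheadA-resp (go _ _ _) (go _ _ _) (stop _ _ _) (stop _ _ _) _ _ _ = tt
AheadA-resp (go _ _ y) (go _ _ .y) (go _ _ w) (go _ _ .w) refl refl h = h

AheadA-stop : ∀ R {T ps B} → AheadA R (stop T ps B)
AheadA-stop (stop _ _ _) = tt
AheadA-stop (go _ _ _) = tt

readRight : ∀ {lo k X rb' rt ra} j → Frame lo k X rb' rt → AgreeUpTo (suc (suc k)) ra rt → k < j → j ≤ suc (suc k) →
            nth ra j ≡ nth rb' j
readRight j fr (agree a) k<j j≤ = trans (a j j≤) (Frame-outside j fr (inj₁ k<j))

placeHere : ∀ k i w ra As x → nth ra (suc k) ≡ just x → nth ra (suc (suc k)) ≡ nothing → w < x →
            Stops (scanCol (suc (suc k)) i w (ra ∷ As))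
placeHere k i w ra As x e₁ e₂ w<x with stepRow (suc (suc k)) w ra | stepView (suc k) w ra
... | .(placed _) | placed _ _ _ _ _ = tt
... | .(bumped _ v) | bumped _ v _ _ c₂ _ = ⊥-elim (just≢nothing (trans (sym c₂) e₂))
... | .skip | skip sk with skip-next {rb = ra} sk e₁ w<x
...   | _ , e , _ = ⊥-elim (just≢nothing (trans (sym e) e₂))

-- a's step on a row holding x > w at position k+1 where b has just bumped
-- y with x: every entry after x is below y, so a places, or carries on
-- an entry below y.
scanA-afterBump : ∀ k i x y w ra As R Rb → SameOutcome R Rb → nth ra (suc k) ≡ just x → w < x →
                  (∀ {v} → nth ra (suc (suc k)) ≡ just v → v < y) →
                  (∀ w' → w' < y → AheadA R (scanCol (suc (suc k)) (suc i) w' As)) →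
                  AheadA Rb (scanCol (suc (suc k)) i w (ra ∷ As))
scanA-afterBump k i x y w ra As R Rb same raHere w<x belowY ih with stepRow (suc (suc k)) w ra | stepView (suc k) w ra
... | .(placed _) | placed _ _ _ _ _ = AheadA-stop Rb
... | .(bumped _ v) | bumped _ v _ _ c₂ _ =
  AheadA-resp R Rb Ra _ same (consBump-outcome _ _ Ra) (ih v (belowY c₂))
  where Ra = scanCol (suc (suc k)) (suc i) v As
... | .skip | skip sk with skip-next {rb = ra} sk raHere w<x
...   | v , e , w<v = AheadA-resp R Rb Ra _ same (consRow-outcome _ Ra) (ih w (<-trans w<v (belowY e)))
  where Ra = scanCol (suc (suc k)) (suc i) w As

scanA-afterSkip : ∀ k i x w ra As R Rb → SameOutcome R Rb → w < x →
                  (∀ w' → w' < x → AheadA R (scanCol (suc (suc k)) (suc i) w' As)) →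
                  AheadA Rb (scanCol (suc (suc k)) i w (ra ∷ As))
scanA-afterSkip k i x w ra As R Rb same w<x ih with stepRow (suc (suc k)) w ra | stepView (suc k) w ra
... | .(placed _) | placed _ _ _ _ _ = AheadA-stop Rb
... | .(bumped _ v) | bumped _ v _ _ _ v≤w =
  AheadA-resp R Rb (scanCol (suc (suc k)) (suc i) v As) _ same (consBump-outcome _ _ _) (ih v (≤-<-trans v≤w w<x))
... | .skip | skip _ =
  AheadA-resp R Rb (scanCol (suc (suc k)) (suc i) w As) _ same (consRow-outcome _ _) (ih w w<x)

-- Invariants: b's scan of column
-- k+2 starts with x, a's scan of column k+3 with w < x; b's rows after the
-- scan differ from T only at positions ≤ k; a's rows agree with T up to
-- position k+2; b's rows decrease.
scanA : ∀ k i x w X lo Bs As Ts → w < x →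
        Pointwise (Frame lo k X) (resTab (scanCol (suc k) i x Bs)) Ts → Pointwise (AgreeUpTo (suc (suc k))) As Ts →
        All Decreasing Bs → AheadA (scanCol (suc k) i x Bs) (scanCol (suc (suc k)) i w As)
scanA k i x w X lo [] [] [] w<x _ _ _ = w<x
scanA k i x w X lo (rb ∷ Bs) [] [] _ pf [] _ = ⊥-elim (scan-nonempty k i x rb Bs pf)
scanA k i x w X lo (rb ∷ Bs) (ra ∷ As) (rt ∷ Ts) w<x pf (ag ∷ pa) (dec ∷ decs) with stepRow (suc k) x rb | stepView k x rb
... | .(placed _) | placed _ _ _ _ len with pf
...   | fr ∷ _ = placeHere k i w ra As x
  (trans (readRight (suc k) fr ag ≤-refl (n≤1+n _)) (subst (λ q → nth (rb ++ [ x ]) q ≡ just x) len (nth-append-≡ rb x)))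
  (trans (readRight (suc (suc k)) fr ag (n≤1+n _) ≤-refl)
         (trans (nth-append-≢ rb x (suc (suc k)) (λ e → 1+n≢n (trans e len)))
                (nth-beyond rb (suc (suc k)) (≤-trans (≤-reflexive len) (n≤1+n _)))))
  w<x
scanA k i x w X lo (rb ∷ Bs) (ra ∷ As) (rt ∷ Ts) w<x pf (ag ∷ pa) (dec ∷ decs) | .(bumped _ y) | bumped l y e₁ x<l e₂ y≤x
  with subst (λ U → Pointwise (Frame lo k X) U (rt ∷ Ts)) (resTab-consBump _ _ (scanCol (suc k) (suc i) y Bs)) pf
...   | fr ∷ pfs =
  scanA-afterBump k i x y w ra As R _ (consBump-outcome _ _ R)
    (trans (readRight (suc k) fr ag ≤-refl (n≤1+n _)) (nth-replaceAt-≡ rb (suc k) x e₂)) w<x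
    (λ e → decreases dec (suc k) y _ e₂ (trans (sym raNext) e))
    (λ w' w'<y → scanA k (suc i) y w' X lo Bs As Ts w'<y pfs pa decs)
  where
  R = scanCol (suc k) (suc i) y Bs
  raNext : nth ra (suc (suc k)) ≡ nth rb (suc (suc k))
  raNext = trans (readRight (suc (suc k)) fr ag (n≤1+n _) ≤-refl) (nth-replaceAt-≢ rb (suc k) x (suc (suc k)) (λ e → 1+n≢n e))
scanA k i x w X lo (rb ∷ Bs) (ra ∷ As) (rt ∷ Ts) w<x pf (ag ∷ pa) (dec ∷ decs) | .skip | skip _
  with subst (λ U → Pointwise (Frame lo k X) U (rt ∷ Ts)) (resTab-consRow _ (scanCol (suc k) (suc i) x Bs)) pf
...   | _ ∷ pfs =
  scanA-afterSkip k i x w ra As R _ (consRow-outcome _ R) w<x (λ w' w'<x → scanA k (suc i) x w' X lo Bs As Ts w'<x pfs pa decs)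
  where R = scanCol (suc k) (suc i) x Bs

StopsRightOf : ℕ → ColRes → Set
StopsRightOf jb (stop _ _ (_ , ja)) = jb < ja
StopsRightOf jb (go _ _ _) = ⊥

EndA : ColRes → ColRes → Set
EndA (stop _ _ (_ , jb)) Ra = StopsRightOf jb Ra
EndA (go _ _ y) Ra = CarriesBelow y Ra

EndA-addBumps : ∀ ps ps' R R' → EndA R R' → EndA (addBumps ps R) (addBumps ps' R')
EndA-addBumps ps ps' (stop _ _ _) (stop _ _ _) e = e
EndA-addBumps ps ps' (go _ _ _) (stop _ _ _) e = e
EndA-addBumps ps ps' (go _ _ _) (go _ _ _) e = e

RowwiseStrictlyRight : List (ℕ × ℕ) → List (ℕ × ℕ) → Set
RowwiseStrictlyRight Pb Pa = ∀ n j j' → (n , j) ∈ Pb → (n , j') ∈ Pa → j < j'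

ClaimA : ℕ → ℕ → ℕ → Tab → Tab → Set
ClaimA k x w B A = EndA (sweep 0 k x B) (sweep 1 k w A) × RowwiseStrictlyRight (boxes (sweep 0 k x B)) (boxes (sweep 1 k w A))

sweepA-bStops : ∀ k w A TB ps nb → Stops (scanCol (suc (suc k)) 0 w A) →
                (∀ {b} → b ∈ ps ++ [ (nb , suc (suc k)) ] → proj₂ b ≡ suc (suc k)) →
                EndA (stop TB ps (nb , suc (suc k))) (sweep 1 (suc k) w A) ×
                RowwiseStrictlyRight (ps ++ [ (nb , suc (suc k)) ]) (boxes (sweep 1 (suc k) w A))
sweepA-bStops k w A TB ps nb stops column with scanCol (suc (suc k)) 0 w A | scan-box (suc k) 0 w A | stops
... | stop TA ps' ba | sbA | _ =
  ≤-reflexive (sym (ScanBox-column (All.lookup sbA (stop∈boxes TA ps' ba)))) ,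
  λ n j j' m m' → subst (_< j') (sym (column m)) (≤-reflexive (sym (ScanBox-column (All.lookup sbA m'))))

-- A box of b in column k+2 (entry h ≥ y, kept in T) and a later box of a
-- in column s+1 ≤ k+2 (entry ≤ w' < y over an old entry at most it) cannot
-- share a row: in T the entry at position s is at least h.
earlierBox-clash : ∀ k x B TB ps y w' TA T n j j' → T ≡ resTab (sweep 0 k y TB) → All Decreasing T →
                   Pointwise (AgreeUpTo (suc k)) TA T → w' < y →
                   ScanBox k 0 x B (go TB ps y) (n , j) → SweepBox 1 k w' TA (sweep 1 k w' TA) (n , j') → ⊥
earlierBox-clash k x B TB ps y w' TA T zero j j' eT dec agT w'<y () _
earlierBox-clash k x B TB ps y w' TA T (suc n) j zero eT dec agT w'<y _ ()
earlierBox-clash k x B TB ps y w' TA T (suc n) j (suc s) eT dec agT w'<y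
  (_ , _ , _ , r' , h , _ , e₂ , e₃ , _ , y≤h , _) (_ , s≤ , ra , _ , ha , ea , _ , _ , ha≤w' , _ , old)
  with Pointwise-nth n (sweep-frame 0 k y TB) e₂
... | rt , et , fr with Pointwise-nth n agT ea
...   | rt' , et' , agree a with trans (sym et') (trans (cong (λ U → nth U n) eT) et)
...     | refl with Decreasing-mono rt (All-nth T n dec et') s (suc k) h s≤ (trans (Frame-outside (suc k) fr (inj₁ ≤-refl)) e₃)
...       | u , eu , h≤u with EmptyOrAtMost-transport {ra} {rt} {s} (a s s≤) old
...         | inj₁ en = just≢nothing (trans (sym eu) en)
...         | inj₂ (v , ev , v≤ha) with trans (sym eu) ev
...           | refl = <⇒≱ (<-≤-trans w'<y (≤-trans y≤h h≤u)) (≤-trans v≤ha ha≤w')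

sweepA-bGoes : ∀ k x w B A TB ps y T → T ≡ resTab (sweep 0 k y TB) → All Decreasing T →
               All (ScanBox k 0 x B (go TB ps y)) ps → CarriesBelow y (scanCol (suc (suc k)) 0 w A) →
               (∀ w' A' → w' < y → Pointwise (AgreeUpTo (suc k)) A' T → ClaimA k y w' TB A') →
               Pointwise (AgreeUpTo (suc (suc k))) A T →
               EndA (addBumps ps (sweep 0 k y TB)) (sweep 1 (suc k) w A) ×
               RowwiseStrictlyRight (boxes (addBumps ps (sweep 0 k y TB))) (boxes (sweep 1 (suc k) w A))
sweepA-bGoes k x w B A TB ps y T eT dec sbB below ih agr
  with scanCol (suc (suc k)) 0 w A | scan-box (suc k) 0 w A | scan-frame (suc k) 0 w A | below
... | stop TA ps' ba | sbA | _ | _ = end Fb refl , boxClaim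
  where
  Fb = sweep 0 k y TB
  columnA : proj₂ ba ≡ suc (suc (suc k))
  columnA = ScanBox-column (All.lookup sbA (stop∈boxes TA ps' ba))
  end : ∀ F → F ≡ Fb → EndA (addBumps ps F) (stop TA ps' ba)
  end (stop _ _ (_ , jf)) e =
    subst (jf <_) (sym columnA)
      (s≤s (≤-trans (subst (λ G → finalColumn G ≤ suc k) (sym e) (sweep-finalColumn 0 k y TB)) (n≤1+n _)))
  end (go _ _ _) e = tt
  boxClaim : RowwiseStrictlyRight (boxes (addBumps ps Fb)) (ps' ++ [ ba ])
  boxClaim n j j' m m' with ∈-++⁻ ps (subst ((n , j) ∈_) (boxes-addBumps ps Fb) m)
  ... | inj₁ mb = subst (_< j') (sym (ScanBox-column (All.lookup sbB mb))) (≤-reflexive (sym (ScanBox-column (All.lookup sbA m'))))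
  ... | inj₂ mb = subst (j <_) (sym (ScanBox-column (All.lookup sbA m')))
                    (s≤s (≤-trans (SweepBox-column≤ (All.lookup (sweep-box 0 k y TB) mb)) (n≤1+n _)))
... | go TA ps' w' | sbA | frA | w'<y = EndA-addBumps ps ps' Fb Fa (proj₁ claim) , boxClaim
  where
  Fb = sweep 0 k y TB
  Fa = sweep 1 k w' TA
  agT = AgreeUpTo-afterScans frA agr
  claim = ih w' TA w'<y agT
  boxClaim : RowwiseStrictlyRight (boxes (addBumps ps Fb)) (boxes (addBumps ps' Fa))
  boxClaim n j j' m m' with ∈-++⁻ ps (subst ((n , j) ∈_) (boxes-addBumps ps Fb) m)
                          | ∈-++⁻ ps' (subst ((n , j') ∈_) (boxes-addBumps ps' Fa) m')
  ... | inj₁ mb | inj₁ ma =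
    subst (_< j') (sym (ScanBox-column (All.lookup sbB mb))) (≤-reflexive (sym (ScanBox-column (All.lookup sbA ma))))
  ... | inj₂ mb | inj₁ ma = subst (j <_) (sym (ScanBox-column (All.lookup sbA ma)))
                              (s≤s (≤-trans (SweepBox-column≤ (All.lookup (sweep-box 0 k y TB) mb)) (n≤1+n _)))
  ... | inj₂ mb | inj₂ ma = proj₂ claim n j j' mb ma
  ... | inj₁ mb | inj₂ ma =
    ⊥-elim (earlierBox-clash k x B TB ps y w' TA T n j j' eT dec agT w'<y
              (All.lookup sbB mb) (All.lookup (sweep-box 1 k w' TA) ma))

sweepA : ∀ k x w B A T → w < x → T ≡ resTab (sweep 0 k x B) → Pointwise (AgreeUpTo (suc k)) A T →
         All Decreasing B → All Decreasing T → ClaimA k x w B A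
sweepA zero x w B A T w<x eT agr decB dec = w<x , λ n j j' ()
sweepA (suc k) x w B A T w<x eT agr decB dec
  with scanCol (suc k) 0 x B | scan-box k 0 x B | scan-decreasing k 0 x B decB | (λ X lo → scanA k 0 x w X lo B A T)
... | stop TB ps (nb , jb) | sbB | _ | scan with ScanBox-column (All.lookup sbB (stop∈boxes TB ps (nb , jb)))
...   | refl = sweepA-bStops k w A TB ps nb
                 (scan 0 1 w<x (subst (Pointwise (Frame 1 k 0) TB) (sym eT) (Pointwise.refl Frame-refl)) agr decB)
                 (λ m → ScanBox-column (All.lookup sbB m))
sweepA (suc k) x w B A T w<x eT agr decB dec | go TB ps y | sbB | decTB | scan =
  sweepA-bGoes k x w B A TB ps y T eT' dec sbB
    (scan y 1 w<x (subst (Pointwise (Frame 1 k y) TB) (sym eT') (sweep-frame 0 k y TB)) agr decB)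
    (λ w' A' w'<y agr' → sweepA k y w' TB A' T w'<y eT' agr' decTB dec) agr
  where
  eT' : T ≡ resTab (sweep 0 k y TB)
  eT' = trans eT (resTab-addBumps ps (sweep 0 k y TB))

shiftRow-cases : ∀ s m → (m ≤ s × shiftRow s m ≡ m) ⊎ (s < m × shiftRow s m ≡ suc m)
shiftRow-cases s m with m ≤? s
... | yes m≤s = inj₁ (m≤s , shiftRow-≤ m≤s)
... | no m≰s = inj₂ (≰⇒> m≰s , shiftRow-> (≰⇒> m≰s))

shiftRow-injective : ∀ s m n → shiftRow s m ≡ shiftRow s n → m ≡ n
shiftRow-injective s m n e with shiftRow-cases s m | shiftRow-cases s n
... | inj₁ (_ , e₁) | inj₁ (_ , e₂) = trans (sym e₁) (trans e e₂)
... | inj₁ (m≤s , e₁) | inj₂ (s<n , e₂) =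
  ⊥-elim (<⇒≱ s<n (≤-trans (n≤1+n n) (≤-trans (≤-reflexive (sym (trans (sym e₁) (trans e e₂)))) m≤s)))
... | inj₂ (s<m , e₁) | inj₁ (n≤s , e₂) =
  ⊥-elim (<⇒≱ s<m (≤-trans (n≤1+n m) (≤-trans (≤-reflexive (trans (sym e₁) (trans e e₂))) n≤s)))
... | inj₂ (_ , e₁) | inj₂ (_ , e₂) = suc-injective (trans (sym e₁) (trans e e₂))

shiftRow-≢ : ∀ s m → shiftRow s m ≢ suc s
shiftRow-≢ s m e with shiftRow-cases s m
... | inj₁ (m≤s , e₁) = 1+n≰n (subst (_≤ s) (trans (sym e₁) e) m≤s)
... | inj₂ (s<m , e₁) = <-irrefl (sym (suc-injective (trans (sym e₁) e))) s<m

∈-shiftBoxes : ∀ s i j ps → (i , j) ∈ map (shiftBox s) ps → ∃ λ n → i ≡ shiftRow s n × (n , j) ∈ ps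
∈-shiftBoxes s i j ps m with ∈-map⁻ (shiftBox s) m
... | (n , _) , mem , refl = n , refl , mem

∈-shiftBoxes⁻ : ∀ s i j ps → (shiftRow s i , j) ∈ map (shiftBox s) ps → (i , j) ∈ ps
∈-shiftBoxes⁻ s i j ps m with ∈-shiftBoxes s (shiftRow s i) j ps m
... | n , e , mem rewrite shiftRow-injective s i n e = mem

∈-[-] : ∀ {a b : ℕ × ℕ} → a ∈ [ b ] → a ≡ b
∈-[-] (here e) = e

∈-newRowPath : ∀ p ps i j → (i , j) ∈ map (shiftBox p) ps ++ [ (suc p , 1) ] →
               (i ≡ suc p × j ≡ 1) ⊎ (∃ λ n → i ≡ shiftRow p n × (n , j) ∈ ps)
∈-newRowPath p ps i j m with ∈-++⁻ (map (shiftBox p) ps) m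
... | inj₁ mm = inj₂ (∈-shiftBoxes p i j ps mm)
... | inj₂ ms with ∈-[-] ms
...   | refl = inj₁ (refl , refl)

WeaklyLeft : InsResult → InsResult → Set
WeaklyLeft I J = colOf (newBox J) ≤ colOf (newBox I) ×
  (∀ i j j' → (i , j) ∈ path I → (rowMap J i , j') ∈ path J → j' ≤ j)

StrictlyRight : InsResult → InsResult → Set
StrictlyRight I J = colOf (newBox I) < colOf (newBox J) ×
  (∀ i j j' → (i , j) ∈ path I → (rowMap J i , j') ∈ path J → j < j')

sweep-decreasing-on : ∀ N b U R → All Decreasing U → sweep 0 N b U ≡ R → All Decreasing (resTab R)
sweep-decreasing-on N b U R dec e = subst (λ R' → All Decreasing (resTab R')) e (sweep-decreasing 0 N b U dec)

insertC-bStops : ∀ U b c T ps B → All Decreasing U → b ≤ c → insCols (maxLen U) b U ≡ stop T ps B →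
                 WeaklyLeft (fromSweep (stop T ps B)) (insert T c)
insertC-bStops U b c T ps (nb , jb) dec b≤c eB = goal
  where
  N = maxLen U + maxLen T
  eB' = trans (sym (insCols≡sweep-from N b U (m≤m+n _ _))) eB
  claim : EndC (stop T ps (nb , jb)) (sweep 0 N c T) × RowwiseWeaklyLeft (ps ++ [ (nb , jb) ]) (boxes (sweep 0 N c T))
  claim = subst (λ R → EndC R (sweep 0 N c T) × RowwiseWeaklyLeft (boxes R) (boxes (sweep 0 N c T))) eB'
            (sweepC N b c U T T b≤c (cong resTab (sym eB')) (Pointwise.refl AgreeUpTo-refl) (sweep-decreasing-on N b U _ dec eB'))
  result : ∀ RC → EndC (stop T ps (nb , jb)) RC × RowwiseWeaklyLeft (ps ++ [ (nb , jb) ]) (boxes RC) →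
           WeaklyLeft (fromSweep (stop T ps (nb , jb))) (fromSweep RC)
  result (stop _ _ _) c = c
  result (go T₂ ps₂ y₂) (end , rows) = end , λ i j j' m m' → fromPath i j j' m (∈-++⁻ (map (shiftBox p₂) ps₂) m')
    where
    p₂ = newRowPos y₂ T₂
    fromPath : ∀ i j j' → (i , j) ∈ ps ++ [ (nb , jb) ] →
               (shiftRow p₂ i , j') ∈ map (shiftBox p₂) ps₂ ⊎ (shiftRow p₂ i , j') ∈ [ (suc p₂ , 1) ] → j' ≤ j
    fromPath i j j' m (inj₁ mm) = rows i j j' m (∈-shiftBoxes⁻ p₂ i j' ps₂ mm)
    fromPath i j j' m (inj₂ ms) = ⊥-elim (shiftRow-≢ p₂ i (cong proj₁ (∈-[-] ms)))
  goal : WeaklyLeft (fromSweep (stop T ps (nb , jb))) (insert T c)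
  goal rewrite insert≡fromSweep T c | insCols≡sweep-from N c T (m≤n+m _ _) = result (sweep 0 N c T) claim

-- c ≥ b, when inserting b creates the new row [y]: that row is inert for c.
insertC-bGoes : ∀ U b c T' ps y → All Decreasing U → b ≤ c → insCols (maxLen U) b U ≡ go T' ps y →
                WeaklyLeft (fromSweep (go T' ps y)) (insert (insertRow (newRowPos y T') y T') c)
insertC-bGoes U b c T' ps y dec b≤c eB = goal
  where
  p = newRowPos y T'
  TT = insertRow p y T'
  N = maxLen U + maxLen TT
  RC = sweep 0 N c T'
  eB' = trans (sym (insCols≡sweep-from N b U (m≤m+n _ _))) eB
  claim : EndC (go T' ps y) RC × RowwiseWeaklyLeft ps (boxes RC)
  claim = subst (λ R → EndC R RC × RowwiseWeaklyLeft (boxes R) (boxes RC)) eB'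
            (sweepC N b c U T' T' b≤c (cong resTab (sym eB')) (Pointwise.refl AgreeUpTo-refl) (sweep-decreasing-on N b U _ dec eB'))
  eC : insCols (maxLen TT) c TT ≡ shiftResult p p y RC
  eC = trans (insCols≡sweep-from N c TT (m≤n+m _ _)) (sweep-insertRow 0 N c T' p y (inj₂ (proj₁ claim)))
  result : ∀ R → EndC (go T' ps y) R × RowwiseWeaklyLeft ps (boxes R) →
           WeaklyLeft (fromSweep (go T' ps y)) (fromSweep (shiftResult p p y R))
  result (go T₂ ps₂ y₂) (_ , rows) =
    ≤-refl , λ i j j' m m' → fromPaths i j j' m (∈-++⁻ (map (shiftBox p₂) (map (shiftBox p) ps₂)) m')
    where
    p₂ = newRowPos y₂ (insertRow p y T₂)
    fromPaths : ∀ i j j' → (i , j) ∈ map (shiftBox p) ps ++ [ (suc p , 1) ] →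
                (shiftRow p₂ i , j') ∈ map (shiftBox p₂) (map (shiftBox p) ps₂) ⊎ (shiftRow p₂ i , j') ∈ [ (suc p₂ , 1) ] →
                j' ≤ j
    fromPaths i j j' m (inj₂ ms) = ⊥-elim (shiftRow-≢ p₂ i (cong proj₁ (∈-[-] ms)))
    fromPaths i j j' m (inj₁ mm)
      with ∈-shiftBoxes p i j' ps₂ (∈-shiftBoxes⁻ p₂ i j' (map (shiftBox p) ps₂) mm) | ∈-newRowPath p ps i j m
    ... | n , e , mc | inj₁ (refl , _) = ⊥-elim (shiftRow-≢ p n (sym e))
    ... | n , e , mc | inj₂ (n' , e' , mb) rewrite shiftRow-injective p n' n (trans (sym e') e) = rows n j j' mb mc
  goal : WeaklyLeft (fromSweep (go T' ps y)) (insert TT c)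
  goal rewrite insert≡fromSweep TT c | eC = result RC claim

insert-weaklyLeft : ∀ U b c → All Decreasing U → b ≤ c → WeaklyLeft (insert U b) (insert (tab (insert U b)) c)
insert-weaklyLeft U b c dec b≤c rewrite insert≡fromSweep U b = byCase (insCols (maxLen U) b U) refl
  where
  byCase : ∀ RB → insCols (maxLen U) b U ≡ RB → WeaklyLeft (fromSweep RB) (insert (tab (fromSweep RB)) c)
  byCase (stop T ps B) eB = insertC-bStops U b c T ps B dec b≤c eB
  byCase (go T' ps y) eB = insertC-bGoes U b c T' ps y dec b≤c eB

insertRow-nth : ∀ p y (L : Tab) n i {r} → nth L n ≡ just r → shiftRow p (suc n) ≡ suc i → nth (insertRow p y L) i ≡ just r
insertRow-nth p y L n i e es with shiftRow-cases p (suc n)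
... | inj₁ (le , e₁) with suc-injective (trans (sym es) e₁)
...   | refl = before p L n e le
  where
  before : ∀ p (L : Tab) n {r} → nth L n ≡ just r → n < p → nth (insertRow p y L) n ≡ just r
  before (suc p) (x ∷ L) zero e _ = e
  before (suc p) (x ∷ L) (suc n) e (s≤s lt) = before p L n e lt
insertRow-nth p y L n i e es | inj₂ (lt , e₁) with suc-injective (trans (sym es) e₁)
...   | refl = after p L n e (≤-pred lt)
  where
  after : ∀ p (L : Tab) n {r} → nth L n ≡ just r → p ≤ n → nth (insertRow p y L) (suc n) ≡ just r
  after zero L n e _ = e
  after (suc p) (x ∷ L) (suc n) e (s≤s le) = after p L n e le

insertA-bStops : ∀ U a b T ps B → All Decreasing U → a < b → insCols (maxLen U) b U ≡ stop T ps B →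
                 StrictlyRight (fromSweep (stop T ps B)) (insert T a)
insertA-bStops U a b T ps (nb , jb) dec a<b eB = goal
  where
  N = maxLen U + maxLen T
  RA = sweep 1 N a T
  eB' = trans (sym (insCols≡sweep-from N b U (m≤m+n _ _))) eB
  claim : EndA (stop T ps (nb , jb)) RA × RowwiseStrictlyRight (ps ++ [ (nb , jb) ]) (boxes RA)
  claim = subst (λ R → EndA R RA × RowwiseStrictlyRight (boxes R) (boxes RA)) eB'
            (sweepA N b a U T T a<b (cong resTab (sym eB')) (Pointwise.refl AgreeUpTo-refl) dec (sweep-decreasing-on N b U _ dec eB'))
  eA : insCols (maxLen T) a T ≡ andThen (sweep 0 1) RA
  eA = trans (insCols≡sweep-from (suc N) a T (≤-trans (m≤n+m _ _) (n≤1+n N))) (sweep-split 0 N a T)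
  result : ∀ R → EndA (stop T ps (nb , jb)) R × RowwiseStrictlyRight (ps ++ [ (nb , jb) ]) (boxes R) →
           StrictlyRight (fromSweep (stop T ps (nb , jb))) (fromSweep (andThen (sweep 0 1) R))
  result (stop _ _ _) c = c
  goal : StrictlyRight (fromSweep (stop T ps (nb , jb))) (insert T a)
  goal rewrite insert≡fromSweep T a | eA = result RA claim

-- A box of b in column s+1 ≥ 2 (entry at least y) and a box of a's final
-- scan of column 2 (entry ≤ w' < y over an old entry at most it) cannot
-- share a row: the old entry at position 1 is that of b's row, hence at
-- least b's entry.
column2-clash : ∀ N b U T' ps y a T₂ w' p R i n j j' → All Decreasing T' → Pointwise (Frame 2 (suc N) a) T' T₂ → w' < y →
                i ≡ shiftRow p n → SweepBox 0 N b U (go T' ps y) (n , j) → ScanBox 0 0 w' (insertRow p y T₂) R (i , j') → ⊥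
column2-clash N b U T' ps y a T₂ w' p R i zero j j' dec fr w'<y e () _
column2-clash N b U T' ps y a T₂ w' p R i (suc n) zero j' dec fr w'<y e () _
column2-clash N b U T' ps y a T₂ w' p R zero (suc n) (suc s) j' dec fr w'<y e _ ()
column2-clash N b U T' ps y a T₂ w' p R (suc i) (suc n) (suc s) j' dec fr w'<y e
  (1≤s , _ , _ , rb , hb , _ , eb , ehb , _ , y≤hb , _) (_ , _ , r , _ , h , er , _ , _ , h≤w' , _ , old , _)
  with Pointwise-nth n fr eb
... | r₂ , e₂ , fr₂ with trans (sym er) (insertRow-nth p y T₂ n i e₂ (sym e))
...   | refl with Decreasing-mono rb (All-nth T' n dec eb) 1 s hb 1≤s ehb
...     | u , eu , hb≤u with EmptyOrAtMost-transport {r} {rb} {1} (Frame-outside 1 fr₂ (inj₂ ≤-refl)) old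
...       | inj₁ en = just≢nothing (trans (sym eu) en)
...       | inj₂ (v , ev , v≤h) with trans (sym eu) ev
...         | refl = <⇒≱ (<-≤-trans w'<y (≤-trans y≤hb hb≤u)) (≤-trans v≤h h≤w')

insertA-aStops : ∀ N a T' ps y T₂ ps₂ B₂ → All (SweepBox 1 N a T' (stop T₂ ps₂ B₂)) (boxes (stop T₂ ps₂ B₂)) →
                 RowwiseStrictlyRight ps (ps₂ ++ [ B₂ ]) →
                 StrictlyRight (fromSweep (go T' ps y))
                   (fromSweep (andThen (sweep 0 1) (shiftResult (newRowPos y T') (newRowPos y T') y (stop T₂ ps₂ B₂))))
insertA-aStops N a T' ps y T₂ ps₂ (n₂ , j₂) sbA rows =
  ≤-trans (s≤s (s≤s z≤n)) (SweepBox-column≥ (All.lookup sbA (stop∈boxes T₂ ps₂ (n₂ , j₂)))) , fromPaths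
  where
  p = newRowPos y T'
  fromPaths : ∀ i j j' → (i , j) ∈ map (shiftBox p) ps ++ [ (suc p , 1) ] →
              (i , j') ∈ map (shiftBox p) ps₂ ++ [ shiftBox p (n₂ , j₂) ] → j < j'
  fromPaths i j j' m m'
    with ∈-shiftBoxes p i j' (ps₂ ++ [ (n₂ , j₂) ]) (subst ((i , j') ∈_) (sym (map-++ (shiftBox p) ps₂ [ (n₂ , j₂) ])) m')
  ... | n , e , ma with ∈-newRowPath p ps i j m
  ...   | inj₁ (refl , refl) = ≤-trans (s≤s (s≤s z≤n)) (SweepBox-column≥ (All.lookup sbA ma))
  ...   | inj₂ (n' , e' , mb) rewrite shiftRow-injective p n' n (trans (sym e') e) = rows n j j' mb ma

-- a < b with b creating the new row [y]; a's sweep shifted one column right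
-- carries w' < y on, so a's scan of column 2 stops, at the latest in [y].
insertA-aGoes : ∀ N a b U T' ps y T₂ ps₂ w' → All Decreasing T' → All (SweepBox 0 N b U (go T' ps y)) ps →
                Pointwise (Frame 2 (suc N) a) T' T₂ → w' < y → RowwiseStrictlyRight ps ps₂ →
                StrictlyRight (fromSweep (go T' ps y))
                  (fromSweep (andThen (sweep 0 1) (shiftResult (newRowPos y T') (newRowPos y T') y (go T₂ ps₂ w'))))
insertA-aGoes N a b U T' ps y T₂ ps₂ w' dec sbB fr w'<y rows
  with scanCol 1 0 w' (insertRow (newRowPos y T') y T₂) | scan-stopsAt 0 w' T₂ (newRowPos y T') y w'<y
     | scan-box 0 0 w' (insertRow (newRowPos y T') y T₂)
... | stop T₃ ps₃ B₃ | _ | sb₃ = ≤-reflexive (sym (ScanBox-column (All.lookup sb₃ (stop∈boxes T₃ ps₃ B₃)))) , fromPaths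
  where
  p = newRowPos y T'
  qs = map (shiftBox p) ps₂
  fromPaths : ∀ i j j' → (i , j) ∈ map (shiftBox p) ps ++ [ (suc p , 1) ] → (i , j') ∈ (qs ++ ps₃) ++ [ B₃ ] → j < j'
  fromPaths i j j' m m' with ∈-++⁻ qs (subst ((i , j') ∈_) (++-assoc qs ps₃ [ B₃ ]) m') | ∈-newRowPath p ps i j m
  ... | inj₁ mm | bSide with ∈-shiftBoxes p i j' ps₂ mm | bSide
  ...   | n , e , _ | inj₁ (refl , _) = ⊥-elim (shiftRow-≢ p n (sym e))
  ...   | n , e , ma | inj₂ (n' , e' , mb) rewrite shiftRow-injective p n' n (trans (sym e') e) = rows n j j' mb ma
  fromPaths i j j' m m' | inj₂ ms | inj₁ (refl , refl) =
    ≤-reflexive (sym (ScanBox-column {0} {0} {w'} {insertRow p y T₂} {stop T₃ ps₃ B₃} {n = suc p} (All.lookup sb₃ ms)))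
  fromPaths i j j' m m' | inj₂ ms | inj₂ (n' , e' , mb) =
    ⊥-elim (column2-clash N b U T' ps y a T₂ w' p (stop T₃ ps₃ B₃) i n' j j' dec fr w'<y e'
              (All.lookup sbB mb) (All.lookup sb₃ ms))

-- a < b, when inserting b creates the new row [y]: that row is inert for
-- a's sweep of the columns ≥ 3.
insertA-bGoes : ∀ U a b T' ps y → All Decreasing U → a < b → insCols (maxLen U) b U ≡ go T' ps y →
                StrictlyRight (fromSweep (go T' ps y)) (insert (insertRow (newRowPos y T') y T') a)
insertA-bGoes U a b T' ps y dec a<b eB = goal
  where
  p = newRowPos y T'
  TT = insertRow p y T'
  N = maxLen U + maxLen TT
  RA = sweep 1 N a T'
  eB' = trans (sym (insCols≡sweep-from N b U (m≤m+n _ _))) eB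
  decT' = sweep-decreasing-on N b U _ dec eB'
  claim : EndA (go T' ps y) RA × RowwiseStrictlyRight ps (boxes RA)
  claim = subst (λ R → EndA R RA × RowwiseStrictlyRight (boxes R) (boxes RA)) eB'
            (sweepA N b a U T' T' a<b (cong resTab (sym eB')) (Pointwise.refl AgreeUpTo-refl) dec decT')
  sbB : All (SweepBox 0 N b U (go T' ps y)) ps
  sbB = subst (λ R → All (SweepBox 0 N b U R) (boxes R)) eB' (sweep-box 0 N b U)
  eA : insCols (maxLen TT) a TT ≡ andThen (sweep 0 1) (shiftResult p p y RA)
  eA = trans (insCols≡sweep-from (suc N) a TT (≤-trans (m≤n+m _ _) (n≤1+n N)))
         (trans (sweep-split 0 N a TT) (cong (andThen (sweep 0 1)) (sweep-insertRow 1 N a T' p y (inj₁ (s≤s z≤n)))))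
  result : ∀ R → EndA (go T' ps y) R × RowwiseStrictlyRight ps (boxes R) → All (SweepBox 1 N a T' R) (boxes R) →
           Pointwise (Frame 2 (suc N) a) T' (resTab R) →
           StrictlyRight (fromSweep (go T' ps y)) (fromSweep (andThen (sweep 0 1) (shiftResult p p y R)))
  result (stop T₂ ps₂ B₂) (_ , rows) sbA _ = insertA-aStops N a T' ps y T₂ ps₂ B₂ sbA rows
  result (go T₂ ps₂ w') (w'<y , rows) _ fr = insertA-aGoes N a b U T' ps y T₂ ps₂ w' decT' sbB fr w'<y rows
  goal : StrictlyRight (fromSweep (go T' ps y)) (insert TT a)
  goal rewrite insert≡fromSweep TT a | eA = result RA claim (sweep-box 1 N a T') (sweep-frame 1 N a T')

insert-strictlyRight : ∀ U a b → All Decreasing U → a < b → StrictlyRight (insert U b) (insert (tab (insert U b)) a)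
insert-strictlyRight U a b dec a<b rewrite insert≡fromSweep U b = byCase (insCols (maxLen U) b U) refl
  where
  byCase : ∀ RB → insCols (maxLen U) b U ≡ RB → StrictlyRight (fromSweep RB) (insert (tab (fromSweep RB)) a)
  byCase (stop T ps B) eB = insertA-bStops U a b T ps B dec a<b eB
  byCase (go T' ps y) eB = insertA-bGoes U a b T' ps y dec a<b eB

All-fromNth : ∀ {P : Row → Set} (U : Tab) → (∀ n {r} → nth U n ≡ just r → P r) → All P U
All-fromNth [] f = []
All-fromNth (r ∷ U) f = f 0 refl ∷ All-fromNth U (λ n → f (suc n))

rct-decreasing : ∀ U → IsRCT U → All Decreasing U
rct-decreasing U rct = All-fromNth U λ n e → decreasing (λ j u v e₁ e₂ → rowDecreases n e j e₁ e₂)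
  where
  open IsRCT rct
  rowDecreases : ∀ n {r} → nth U n ≡ just r → ∀ j {u v} → nth r j ≡ just u → nth r (suc j) ≡ just v → v < u
  rowDecreases n {r} e j e₁ e₂
    with rowStrict (suc n) (suc j) (s≤s z≤n) (nth-just⇒< U n e) (s≤s z≤n)
                   (subst (suc (suc j) ≤_) (sym (cong (maybe′ length 0) e)) (nth-just⇒< r (suc j) e₂))
  ... | lt rewrite e | e₁ | e₂ = lt

mainTheorem2 : (U : Tab) (a b c : ℕ) → IsRCT U → 1 ≤ a → a < b → b ≤ c →
    (colOf (newBox (insert (tab (insert U b)) c)) ≤ colOf (newBox (insert U b)))
    × (colOf (newBox (insert U b)) < colOf (newBox (insert (tab (insert U b)) a)))
    × (∀ i j j' → (i , j) ∈ path (insert U b) →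
         (rowMap (insert (tab (insert U b)) c) i , j') ∈ path (insert (tab (insert U b)) c) →
         j' ≤ j)
    × (∀ i j j' → (i , j) ∈ path (insert U b) →
         (rowMap (insert (tab (insert U b)) a) i , j') ∈ path (insert (tab (insert U b)) a) →
         j < j')
mainTheorem2 U a b c rct _ a<b b≤c = proj₁ weak , proj₁ strict , proj₂ weak , proj₂ strict
  where
  decreasingRows : All Decreasing U
  decreasingRows = rct-decreasing U rct
  weak : WeaklyLeft (insert U b) (insert (tab (insert U b)) c)
  weak = insert-weaklyLeft U b c decreasingRows b≤c
  strict : StrictlyRight (insert U b) (insert (tab (insert U b)) a)
  strict = insert-strictlyRight U a b decreasingRows a<b
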